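{- Let $n>4$ and let $w\in W(\widetilde{C}_n)$ be fully commutative and non-cancellable, and let $k\ge1$. If $\mathbf{r}_{k+1}=\mathsf{x}_{\mathcal{O}}$, then $\mathbf{r}_k=\mathsf{x}_{\mathcal{E}}$; and if $\mathbf{r}_{k+1}=\mathsf{x}_{\mathcal{E}}$, then $\mathbf{r}_k=\mathsf{x}_{\mathcal{O}}$.
   Context: $W(\widetilde{C}_n)$ has generators $s_1,\dots,s_{n+1}$ with $m(s_1,s_2)=m(s_n,s_{n+1})=4$, $m(s_i,s_{i+1})=3$ for $1<i<n$, $m(s_i,s_j)=2$ for $|i-j|\ge2$. $\mathcal{L},\mathcal{R}$ are left/right descent sets. Fully commutative: any two reduced expressions related by moves $st\mapsto ts$ with $m(s,t)=2$. A fully commutative $w$ is left weak star reducible by $s$ w.r.t. $t$ if $m(s,t)\ge3$, $s\in\mathcal{L}(w)$, $t\in\mathcal{L}(sw)$, and $tw$ is not fully commutative; right symmetrically; non-cancellable means neither left nor right weak star reducible by any $s$ w.r.t. any $t$. $\mathsf{x}_{\mathcal{O}}=s_1s_3s_5\cdots$ is the product of all $s_i$ with $i$ odd in $\{1,\dots,n+1\}$, and $\mathsf{x}_{\mathcal{E}}=s_2s_4\cdots$ the product of all $s_i$ with $i$ even in $\{1,\dots,n+1\}$. Heap: for fully commutative $w$ with reduced expression $s_{x_1}\cdots s_{x_r}$, the heap is the poset on $\{1,\dots,r\}$ (entry $p$ labeled $s_{x_p}$) generated by $p$ above $q$ whenever $p<q$ and $s_{x_p},s_{x_q}$ do not commute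 (including equal). An entry is in row 1 if nothing is above it; otherwise its row is $1$ plus the maximum row of entries covering it. $\mathbf{r}_k$ is the $k$-th row, and $\mathbf{r}_k=s_{y_1}\cdots s_{y_m}$ means the entries of row $k$ are labeled exactly by $s_{y_1},\dots,s_{y_m}$, each once. -}

module Defs where

open import Data.Nat using (ℕ; zero; suc; _+_; _<_; _≤_; _⊔_; _≡ᵇ_)
open import Data.Fin using (Fin; toℕ)
open import Data.Bool using (Bool; true; false; _∧_; _∨_; if_then_else_; not)
open import Data.List using (List; []; _∷_; _++_; [_]; map; foldr; length; filterᵇ)
open import Data.Product using (_×_; _,_; proj₁; proj₂; ∃; ∃-syntax)
open import Relation.Nullary using (¬_)
open import Relation.Binary.PropositionalEquality using (_≡_; _≢_)
open import Relation.Binary.Construct.Closure.Equivalence using (EqClosure)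
open import Data.List.Relation.Binary.Permutation.Propositional using (_↭_)

-- Generators of W(C̃_n): s_1, …, s_{n+1} encoded as Fin (suc n),
-- the index i : Fin (suc n) standing for s_{i+1}.
Gen : ℕ → Set
Gen n = Fin (suc n)

Word : ℕ → Set
Word n = List (Gen n)

mℕ : ℕ → ℕ → ℕ → ℕ
mℕ n a b =
  if a ≡ᵇ b then 1
  else if (suc a ≡ᵇ b) ∨ (suc b ≡ᵇ a)
    then (if ((a ≡ᵇ 0) ∨ (b ≡ᵇ 0)) ∨ ((a ≡ᵇ n) ∨ (b ≡ᵇ n)) then 4 else 3)
    else 2

m : (n : ℕ) → Gen n → Gen n → ℕ
m n s t = mℕ n (toℕ s) (toℕ t)

alt : ∀ {n} → Gen n → Gen n → ℕ → Word n
alt s t zero = []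
alt s t (suc k) = s ∷ alt t s k

data CoxRel (n : ℕ) : Word n → Word n → Set where
  square : (s : Gen n) → CoxRel n (s ∷ s ∷ []) []
  braid  : (s t : Gen n) → s ≢ t → CoxRel n (alt s t (m n s t)) (alt t s (m n s t))

data CommRel (n : ℕ) : Word n → Word n → Set where
  comm : (s t : Gen n) → m n s t ≡ 2 → CommRel n (s ∷ t ∷ []) (t ∷ s ∷ [])

data InCtx {n : ℕ} (R : Word n → Word n → Set) : Word n → Word n → Set where
  ctx : (u l r v : Word n) → R l r → InCtx R (u ++ l ++ v) (u ++ r ++ v)

_≈W_ : ∀ {n} → Word n → Word n → Set
_≈W_ {n} = EqClosure (InCtx (CoxRel n))

_≈C_ : ∀ {n} → Word n → Word n → Set
_≈C_ {n} = EqClosure (InCtx (CommRel n))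

Reduced : ∀ {n} → Word n → Set
Reduced {n} w = ∀ (v : Word n) → v ≈W w → length w ≤ length v

HasLength : ∀ {n} → Word n → ℕ → Set
HasLength {n} w k = ∃[ v ] (v ≈W w × Reduced v × length v ≡ k)

FC : ∀ {n} → Word n → Set
FC {n} w = ∀ (u v : Word n) → Reduced u → Reduced v → u ≈W w → v ≈W w → u ≈C v

LDesc : ∀ {n} → Gen n → Word n → Set
LDesc s w = ∃[ a ] ∃[ b ] (HasLength (s ∷ w) a × HasLength w b × a < b)

RDesc : ∀ {n} → Gen n → Word n → Set
RDesc s w = ∃[ a ] ∃[ b ] (HasLength (w ++ [ s ]) a × HasLength w b × a < b)

LeftWeakStarRed : ∀ {n} → Gen n → Gen n → Word n → Set
LeftWeakStarRed {n} s t w =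
  3 ≤ m n s t × LDesc s w × LDesc t (s ∷ w) × ¬ FC (t ∷ w)

RightWeakStarRed : ∀ {n} → Gen n → Gen n → Word n → Set
RightWeakStarRed {n} s t w =
  3 ≤ m n s t × RDesc s w × RDesc t (w ++ [ s ]) × ¬ FC (w ++ [ t ])

NonCancellable : ∀ {n} → Word n → Set
NonCancellable {n} w =
  ∀ (s t : Gen n) → ¬ LeftWeakStarRed s t w × ¬ RightWeakStarRed s t w

-- Entries of the word, left to right, paired with their row.
-- The row of an entry is 1 + the maximal row of earlier entries whose
-- labels do not commute with it (equal or m ≥ 3); 1 if there are none.
noncommᵇ : ∀ {n} → Gen n → Gen n → Bool
noncommᵇ {n} s t = not (m n s t ≡ᵇ 2)

maxRowAbove : ∀ {n} → Gen n → List (Gen n × ℕ) → ℕ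
maxRowAbove x acc =
  foldr (λ e r → if noncommᵇ x (proj₁ e) then proj₂ e ⊔ r else r) 0 acc

heapGo : ∀ {n} → List (Gen n × ℕ) → Word n → List (Gen n × ℕ)
heapGo acc [] = acc
heapGo acc (x ∷ xs) = heapGo (acc ++ [ (x , suc (maxRowAbove x acc)) ]) xs

heapRows : ∀ {n} → Word n → List (Gen n × ℕ)
heapRows = heapGo []

rowLabels : ∀ {n} → Word n → ℕ → Word n
rowLabels w k = map proj₁ (filterᵇ (λ e → proj₂ e ≡ᵇ k) (heapRows w))

-- r_k = y  : the entries of row k are labelled exactly by the letters of y,
-- each once
RowIs : ∀ {n} → Word n → ℕ → Word n → Set
RowIs w k y = rowLabels w k ↭ y

allGens : (n : ℕ) → Word n
allGens n = Data.List.Base.allFin (suc n)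
  where import Data.List.Base

evenℕ : ℕ → Bool
evenℕ zero = true
evenℕ (suc k) = not (evenℕ k)

-- s_i with i odd  ⇔  0-based index i-1 even
xO : (n : ℕ) → Word n
xO n = filterᵇ (λ g → evenℕ (toℕ g)) (allGens n)

xE : (n : ℕ) → Word n
xE n = filterᵇ (λ g → not (evenℕ (toℕ g))) (allGens n)

-- Labels are the 0-based indices of Defs: label x stands for s_(x+1), so x_O collects the even labels.
--
-- In the heap of a reduced, fully commutative, non-cancellable w no label occurs in two consecutive
-- rows, neighbouring labels never share a row, and each entry below row 1 is covered by a neighbouring
-- label in the row above.  Suppose row k+1 contains all labels of one parity and a label x of the other
-- parity is missing from row k.  Then a neighbour of x in row k+1 is covered from one side only; such a
-- "corner" climbs diagonally upwards, because otherwise w would contain a braid a b a up to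
-- commutation.  A climbing corner either reaches row 1, where it makes w left weak star reducible, or
-- reaches one of the walls 0 and n, where m = 4 turns the configuration into a braid a b a b or again
-- a star reduction, or it collides with a corner climbing from the opposite side.  At the wall n the
-- parity of n decides which row below the staircase contains n; this is where n > 4 is needed.

module Submission where

open import Defs
open import Data.Bool using (Bool; true; false; _∨_; not; T; if_then_else_)
open import Data.Bool.Properties using (∨-comm; not-involutive; not-injective; not-¬; T?; T-≡)
open import Data.Nat using (ℕ; zero; suc; _+_; _∸_; _<_; _≤_; _≡ᵇ_; z≤n; s≤s)
open import Data.Nat.Properties as ℕ using ()
open import Data.Fin as Fin using (toℕ; fromℕ<)
open import Data.Fin.Properties using (toℕ<n; toℕ-injective; toℕ-fromℕ<)
open import Data.List using (List; []; _∷_; _++_; length; filter; filterᵇ; map; initLast; _∷ʳ′_)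
open import Data.List.Properties
  using ( ++-assoc; ++-identityʳ; length-++; map-++; ++-cancelˡ; ∷-injectiveˡ; ∷ʳ-injective; ∷ʳ-injectiveˡ
        ; filter-++; filter-accept; filter-reject)
open import Data.List.Membership.Propositional using (_∈_)
open import Data.List.Membership.Propositional.Properties
  using (∈-∃++; ∈-map∘filter⁻; ∈-map∘filter⁺; ∈-filter⁻; ∈-filter⁺; ∈-allFin)
open import Data.List.Membership.Propositional.Properties.WithK using (unique∧set⇒bag)
open import Data.List.Relation.Binary.BagAndSetEquality using (∼bag⇒↭)
open import Data.List.Relation.Binary.Permutation.Propositional using (_↭_; ↭-sym)
open import Data.List.Relation.Binary.Permutation.Propositional.Properties using (∈-resp-↭)
open import Data.List.Relation.Unary.AllPairs using (AllPairs; []; _∷_)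
import Data.List.Relation.Unary.AllPairs.Properties as AllPairs
open import Data.List.Relation.Unary.Unique.Propositional using (Unique)
import Data.List.Relation.Unary.Unique.Propositional.Properties as Unique
open import Data.List.Relation.Unary.Any using (Any; here; there)
import Data.List.Relation.Unary.Any as Any
import Data.List.Relation.Unary.Any.Properties as Any
open import Data.List.Relation.Unary.All using (All; []; _∷_)
import Data.List.Relation.Unary.All as All
import Data.List.Relation.Unary.All.Properties as All
open import Data.Product using (_×_; _,_; proj₁; proj₂; ∃-syntax)
import Data.Product as Product
open import Data.Empty using (⊥; ⊥-elim)
open import Data.Sum using (_⊎_; inj₁; inj₂; [_,_])
import Data.Sum as Sum
open import Function.Base using (id; _∘_)
open import Function.Bundles using (_⇔_; mk⇔; Equivalence)
open import Relation.Nullary using (¬_; Dec; yes; no; contradiction)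
open import Relation.Nullary.Decidable using (_⊎-dec_; _×-dec_; decidable-stable)
open import Relation.Unary using (Decidable)
open import Relation.Binary.PropositionalEquality hiding ([_])
open import Relation.Binary.Construct.Closure.Equivalence using (EqClosure; gmap; gfold; symmetric; return)
open import Relation.Binary.Construct.Closure.ReflexiveTransitive using (ε; _◅◅_)

≡ᵇ-sound : ∀ a b → (a ≡ᵇ b) ≡ true → a ≡ b
≡ᵇ-sound a b e = ℕ.≡ᵇ⇒≡ a b (subst T (sym e) _)

≡ᵇ-refl : ∀ a → (a ≡ᵇ a) ≡ true
≡ᵇ-refl zero = refl
≡ᵇ-refl (suc a) = ≡ᵇ-refl a

≡ᵇ-≢ : ∀ {a b} → a ≢ b → (a ≡ᵇ b) ≡ false
≡ᵇ-≢ {a} {b} a≢b with a ≡ᵇ b in e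
... | true = contradiction (≡ᵇ-sound a b e) a≢b
... | false = refl

≡ᵇ-sym : ∀ a b → (a ≡ᵇ b) ≡ (b ≡ᵇ a)
≡ᵇ-sym zero zero = refl
≡ᵇ-sym zero (suc b) = refl
≡ᵇ-sym (suc a) zero = refl
≡ᵇ-sym (suc a) (suc b) = ≡ᵇ-sym a b

Adj : ℕ → ℕ → Set
Adj a b = suc a ≡ b ⊎ suc b ≡ a

Near : ℕ → ℕ → Set
Near a b = a ≡ b ⊎ Adj a b

Adj-sym : ∀ {a b} → Adj a b → Adj b a
Adj-sym (inj₁ e) = inj₂ e
Adj-sym (inj₂ e) = inj₁ e

Near-sym : ∀ {a b} → Near a b → Near b a
Near-sym (inj₁ e) = inj₁ (sym e)
Near-sym (inj₂ adj) = inj₂ (Adj-sym adj)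

mℕ-sym : ∀ n a b → mℕ n a b ≡ mℕ n b a
mℕ-sym n a b rewrite ≡ᵇ-sym a b | ∨-comm (suc a ≡ᵇ b) (suc b ≡ᵇ a)
  | ∨-comm (a ≡ᵇ 0) (b ≡ᵇ 0) | ∨-comm (a ≡ᵇ n) (b ≡ᵇ n) = refl

mℕ-diag : ∀ n a → mℕ n a a ≡ 1
mℕ-diag n a rewrite ≡ᵇ-refl a = refl

mℕ≢2⇒Near : ∀ n a b → mℕ n a b ≢ 2 → Near a b
mℕ≢2⇒Near n a b m≢2 with a ≡ᵇ b in e₀ | suc a ≡ᵇ b in e₁ | suc b ≡ᵇ a in e₂
... | true  | _     | _     = inj₁ (≡ᵇ-sound a b e₀)
... | false | true  | _     = inj₂ (inj₁ (≡ᵇ-sound _ _ e₁))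
... | false | false | true  = inj₂ (inj₂ (≡ᵇ-sound _ _ e₂))
... | false | false | false = contradiction refl m≢2

mℕ-succ≢2 : ∀ n a → mℕ n a (suc a) ≢ 2
mℕ-succ≢2 n a rewrite ≡ᵇ-≢ {a} {suc a} (ℕ.<⇒≢ (ℕ.n<1+n a)) | ≡ᵇ-refl a = 3-or-4 _
  where
  3-or-4 : ∀ b → (if b then 4 else 3) ≢ 2
  3-or-4 true  = λ ()
  3-or-4 false = λ ()

Near⇒mℕ≢2 : ∀ n {a b} → Near a b → mℕ n a b ≢ 2
Near⇒mℕ≢2 n {a} (inj₁ refl) e = contradiction (trans (sym (mℕ-diag n a)) e) λ ()
Near⇒mℕ≢2 n {a} (inj₂ (inj₁ refl)) = mℕ-succ≢2 n a
Near⇒mℕ≢2 n {b = b} (inj₂ (inj₂ refl)) rewrite mℕ-sym n (suc b) b = mℕ-succ≢2 n b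

mℕ-interior : ∀ n c → 1 ≤ c → suc (suc c) ≤ n → mℕ n c (suc c) ≡ 3
mℕ-interior n zero ()
mℕ-interior n (suc c) _ 3+c≤n
  rewrite ≡ᵇ-≢ {c} {suc c} (ℕ.<⇒≢ (ℕ.n<1+n c)) | ≡ᵇ-refl c
        | ≡ᵇ-≢ {suc c} {n} (ℕ.<⇒≢ (ℕ.≤-trans (ℕ.n≤1+n _) 3+c≤n))
        | ≡ᵇ-≢ {suc (suc c)} {n} (ℕ.<⇒≢ 3+c≤n) = refl

mℕ-interiorʳ : ∀ n c → 1 ≤ c → suc (suc c) ≤ n → mℕ n (suc c) c ≡ 3
mℕ-interiorʳ n c 1≤c 2+c≤n = trans (mℕ-sym n (suc c) c) (mℕ-interior n c 1≤c 2+c≤n)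

mℕ-last : ∀ c → mℕ (suc c) c (suc c) ≡ 4
mℕ-last c rewrite ≡ᵇ-≢ {c} {suc c} (ℕ.<⇒≢ (ℕ.n<1+n c)) | ≡ᵇ-refl c with c ≡ᵇ 0
... | true  = refl
... | false = refl

mℕ-lastʳ : ∀ c → mℕ (suc c) (suc c) c ≡ 4
mℕ-lastʳ c = trans (mℕ-sym (suc c) (suc c) c) (mℕ-last c)

↭-unique : ∀ {A : Set} {xs ys : List A} → Unique xs → Unique ys → (∀ {x} → x ∈ xs ⇔ x ∈ ys) → xs ↭ ys
↭-unique u u′ eq = ∼bag⇒↭ (unique∧set⇒bag u u′ eq)

m<n<2+m⇒n≡1+m : ∀ {m n} → m < n → n < suc (suc m) → n ≡ suc m
m<n<2+m⇒n≡1+m m<n n<2+m = ℕ.≤-antisym (ℕ.≤-pred n<2+m) m<n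

n<2+n : ∀ n → n < suc (suc n)
n<2+n n = ℕ.m<n⇒m<1+n (ℕ.n<1+n n)

least : ∀ {P : ℕ → Set} → Decidable P → ∀ {d} → P d → ∃[ j ] (P j × (∀ {i} → i < j → ¬ P i))
least {P} P? {d} = search 0 d (λ ())
  where
  search : ∀ k gap → (∀ {i} → i < k → ¬ P i) → P (k + gap) → ∃[ j ] (P j × (∀ {i} → i < j → ¬ P i))
  search k gap below p with P? k
  ... | yes pk = k , pk , below
  search k zero below p | no ¬pk = contradiction (subst P (ℕ.+-identityʳ k) p) ¬pk
  search k (suc gap) below p | no ¬pk = search (suc k) gap below′ (subst P (ℕ.+-suc k gap) p)
    where
    below′ : ∀ {i} → i < suc k → ¬ P i
    below′ i<1+k with ℕ.m<1+n⇒m<n∨m≡n i<1+k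
    ... | inj₁ i<k = below i<k
    ... | inj₂ refl = ¬pk

module _ {A : Set} where

  Before : List A → A → A → Set
  Before L x y = ∃[ X ] ∃[ Y ] ∃[ Z ] L ≡ X ++ x ∷ Y ++ y ∷ Z

  Any-split : ∀ {P : A → Set} (L : List A) → Any P L → ∃[ X ] ∃[ x ] ∃[ Y ] (L ≡ X ++ x ∷ Y × P x)
  Any-split (x ∷ L) (here p) = [] , x , L , refl , p
  Any-split (x ∷ L) (there q) with X , y , Y , refl , p ← Any-split L q = x ∷ X , y , Y , refl , p

  ∈-split : ∀ {L X Y : List A} {x} → L ≡ X ++ x ∷ Y → x ∈ L
  ∈-split {X = X} eq = subst (_ ∈_) (sym eq) (Any.++⁺ʳ X (here refl))

  Before⇒∈ˡ : ∀ {L : List A} {x y} → Before L x y → x ∈ L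
  Before⇒∈ˡ (X , _ , _ , eq) = ∈-split {X = X} eq

  Before⇒∈ʳ : ∀ {L : List A} {x y} → Before L x y → y ∈ L
  Before⇒∈ʳ {x = x} (X , Y , _ , eq) = ∈-split {X = X ++ x ∷ Y} (trans eq (sym (++-assoc X (x ∷ Y) _)))

  Before-around : ∀ {L X Y Z : List A} {x y z} → L ≡ X ++ x ∷ Y ++ y ∷ Z → z ∈ Y → Before L x z × Before L z y
  Before-around {X = X} {Y} {Z} {x} {y} {z} eq z∈Y with Y₁ , Y₂ , refl ← ∈-∃++ z∈Y =
    (X , Y₁ , Y₂ ++ y ∷ Z , trans eq (cong (λ q → X ++ x ∷ q) (++-assoc Y₁ (z ∷ Y₂) (y ∷ Z)))) ,
    (X ++ x ∷ Y₁ , Y₂ , Z , trans eq (trans (cong (λ q → X ++ x ∷ q) (++-assoc Y₁ (z ∷ Y₂) (y ∷ Z)))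
                                            (sym (++-assoc X (x ∷ Y₁) (z ∷ Y₂ ++ y ∷ Z)))))

  Before-prefix : ∀ {L X Y : List A} {x z} → L ≡ X ++ x ∷ Y → z ∈ X → Before L z x
  Before-prefix {Y = Y} {z = z} eq z∈X with X₁ , X₂ , refl ← ∈-∃++ z∈X =
    X₁ , X₂ , Y , trans eq (++-assoc X₁ (z ∷ X₂) (_ ∷ Y))

  Any-between : ∀ {L X Y Z : List A} {x y} {P : A → Set} → L ≡ X ++ x ∷ Y ++ y ∷ Z → Any P L →
    (∀ {z} → P z → ¬ Before L z x) → ¬ P x → ¬ P y → (∀ {z} → P z → ¬ Before L y z) → Any P Y
  Any-between {X = X} {Y} {Z} {x} {y} {P} eq p ¬before ¬x ¬y ¬after with Any.++⁻ X (subst (Any P) eq p)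
  ... | inj₁ pX with X₁ , z , X₂ , refl , pz ← Any-split X pX =
    contradiction (X₁ , X₂ , Y ++ y ∷ Z , trans eq (++-assoc X₁ (z ∷ X₂) (x ∷ Y ++ y ∷ Z))) (¬before pz)
  ... | inj₂ (here px) = contradiction px ¬x
  ... | inj₂ (there q) with Any.++⁻ Y q
  ...   | inj₁ pY = pY
  ...   | inj₂ (here py) = contradiction py ¬y
  ...   | inj₂ (there pZ) with Z₁ , z , Z₂ , refl , pz ← Any-split Z pZ =
    contradiction (X ++ x ∷ Y , Z₁ , Z₂ , trans eq (sym (++-assoc X (x ∷ Y) (y ∷ Z₁ ++ z ∷ Z₂)))) (¬after pz)

  Any-after : ∀ {L X Y : List A} {x} {P : A → Set} → L ≡ X ++ x ∷ Y → Any P L →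
    (∀ {z} → P z → ¬ Before L z x) → ¬ P x → Any P Y
  Any-after {X = X} {Y} {x} {P} eq p ¬before ¬x with Any.++⁻ X (subst (Any P) eq p)
  ... | inj₁ pX with X₁ , z , X₂ , refl , pz ← Any-split X pX =
    contradiction (X₁ , X₂ , Y , trans eq (++-assoc X₁ (z ∷ X₂) (x ∷ Y))) (¬before pz)
  ... | inj₂ (here px) = contradiction px ¬x
  ... | inj₂ (there pY) = pY

  Ordered : (A → Set) → (A → Set) → List A → Set
  Ordered P Q L = ∃[ x ] ∃[ y ] (P x × Q y × Before L x y)

  Any-order : ∀ {P Q : A → Set} (L : List A) → Any P L → Any Q L →
              Ordered P Q L ⊎ Ordered Q P L ⊎ Any (λ x → P x × Q x) L
  Any-order (x ∷ L) (here p) (here q) = inj₂ (inj₂ (here (p , q)))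
  Any-order (x ∷ L) (here p) (there q) with X , y , Y , refl , qy ← Any-split L q =
    inj₁ (x , y , p , qy , [] , X , Y , refl)
  Any-order (x ∷ L) (there p) (here q) with X , y , Y , refl , py ← Any-split L p =
    inj₂ (inj₁ (x , y , q , py , [] , X , Y , refl))
  Any-order (x ∷ L) (there p) (there q) with Any-order L p q
  ... | inj₁ (y , z , py , qz , X , Y , Z , refl) = inj₁ (y , z , py , qz , x ∷ X , Y , Z , refl)
  ... | inj₂ (inj₁ (y , z , qy , pz , X , Y , Z , refl)) = inj₂ (inj₁ (y , z , qy , pz , x ∷ X , Y , Z , refl))
  ... | inj₂ (inj₂ r) = inj₂ (inj₂ (there r))

module Words (n : ℕ) where

  Commute : Gen n → Gen n → Set
  Commute s t = m n s t ≡ 2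

  Commute-sym : ∀ {s t} → Commute s t → Commute t s
  Commute-sym {s} {t} = trans (mℕ-sym n (toℕ t) (toℕ s))

  Commute⇒≢ : ∀ {s t} → Commute s t → s ≢ t
  Commute⇒≢ {s} c refl = contradiction (trans (sym (mℕ-diag n (toℕ s))) c) λ ()

  3≤m⇒¬Commute : ∀ {s t} → 3 ≤ m n s t → ¬ Commute s t
  3≤m⇒¬Commute 3≤m c = ℕ.<-irrefl refl (subst (3 ≤_) c 3≤m)

  3≤m⇒≢ : ∀ {s t} → 3 ≤ m n s t → s ≢ t
  3≤m⇒≢ {s} 3≤m refl = contradiction (subst (3 ≤_) (mℕ-diag n (toℕ s)) 3≤m) λ { (s≤s ()) }

  ≈-prefix : ∀ {R : Word n → Word n → Set} (p : Word n) {x y} →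
             EqClosure (InCtx R) x y → EqClosure (InCtx R) (p ++ x) (p ++ y)
  ≈-prefix {R} p = gmap (p ++_) shift
    where
    shift : ∀ {x y} → InCtx R x y → InCtx R (p ++ x) (p ++ y)
    shift (ctx u l r v q) =
      subst₂ (InCtx R) (++-assoc p u (l ++ v)) (++-assoc p u (r ++ v)) (ctx (p ++ u) l r v q)

  ≈-cons : ∀ {R : Word n → Word n → Set} a {x y} →
           EqClosure (InCtx R) x y → EqClosure (InCtx R) (a ∷ x) (a ∷ y)
  ≈-cons a = ≈-prefix (a ∷ [])

  ≈C⇒≈W : ∀ {u v : Word n} → u ≈C v → u ≈W v
  ≈C⇒≈W = gmap id commute⇒braid
    where
    commute⇒braid : ∀ {x y} → InCtx (CommRel n) x y → InCtx (CoxRel n) x y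
    commute⇒braid (ctx u _ _ v (comm s t c)) =
      ctx u _ _ v (subst (λ k → CoxRel n (alt s t k) (alt t s k)) c (braid s t (Commute⇒≢ c)))

  commute-past : ∀ a (Y V : Word n) → All (Commute a) Y → (a ∷ Y ++ V) ≈C (Y ++ a ∷ V)
  commute-past a [] V [] = ε
  commute-past a (y ∷ Y) V (c ∷ cs) =
    return (ctx [] (a ∷ y ∷ []) (y ∷ a ∷ []) (Y ++ V) (comm a y c)) ◅◅ ≈-cons y (commute-past a Y V cs)

  pull-forward : ∀ a (Y V : Word n) → All (Commute a) Y → (Y ++ a ∷ V) ≈C (a ∷ Y ++ V)
  pull-forward a Y V cs = symmetric _ (commute-past a Y V cs)

  length-ctx : ∀ (u l r v : Word n) → length l ≡ length r → length (u ++ l ++ v) ≡ length (u ++ r ++ v)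
  length-ctx u l r v eq = begin
    length (u ++ l ++ v)            ≡⟨ length-++ u ⟩
    length u + length (l ++ v)      ≡⟨ cong (length u +_) (length-++ l) ⟩
    length u + (length l + length v) ≡⟨ cong (λ k → length u + (k + length v)) eq ⟩
    length u + (length r + length v) ≡⟨ cong (length u +_) (length-++ r) ⟨
    length u + length (r ++ v)      ≡⟨ length-++ u ⟨
    length (u ++ r ++ v)            ∎
    where open ≡-Reasoning

  length-alt : ∀ (s t : Gen n) k → length (alt s t k) ≡ k
  length-alt s t zero = refl
  length-alt s t (suc k) = cong suc (length-alt t s k)

  ≈C-length : ∀ {u v : Word n} → u ≈C v → length u ≡ length v
  ≈C-length = gfold isEquivalence length λ { (ctx u l r v (comm s t _)) → length-ctx u l r v refl }

  evenℕ-+-2 : ∀ a b → evenℕ (a + suc (suc b)) ≡ evenℕ (a + b)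
  evenℕ-+-2 zero b = not-involutive (evenℕ b)
  evenℕ-+-2 (suc a) b = cong not (evenℕ-+-2 a b)

  ≈W-parity : ∀ {u v : Word n} → u ≈W v → evenℕ (length u) ≡ evenℕ (length v)
  ≈W-parity = gfold isEquivalence (λ w → evenℕ (length w)) parity
    where
    parity : ∀ {x y} → InCtx (CoxRel n) x y → evenℕ (length x) ≡ evenℕ (length y)
    parity (ctx u _ _ v (square s)) = begin
      evenℕ (length (u ++ s ∷ s ∷ v))        ≡⟨ cong evenℕ (length-++ u) ⟩
      evenℕ (length u + suc (suc (length v))) ≡⟨ evenℕ-+-2 (length u) (length v) ⟩
      evenℕ (length u + length v)            ≡⟨ cong evenℕ (length-++ u) ⟨
      evenℕ (length (u ++ v))                ∎
      where open ≡-Reasoning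
    parity (ctx u _ _ v (braid s t _)) =
      cong evenℕ (length-ctx u _ _ v (trans (length-alt s t (m n s t)) (sym (length-alt t s (m n s t)))))

  inPair? : ∀ (a b : Gen n) → Decidable (λ x → x ≡ a ⊎ x ≡ b)
  inPair? a b x = x Fin.≟ a ⊎-dec x Fin.≟ b

  restrict : Gen n → Gen n → Word n → Word n
  restrict a b = filter (inPair? a b)

  restrict-≈C : ∀ {a b} → ¬ Commute a b → ∀ {u v} → u ≈C v → restrict a b u ≡ restrict a b v
  restrict-≈C {a} {b} ¬ab = gfold isEquivalence (restrict a b) step
    where
    P? : Decidable (λ x → x ≡ a ⊎ x ≡ b)
    P? = inPair? a b
    swap : ∀ {s t} v → Commute s t → restrict a b (s ∷ t ∷ v) ≡ restrict a b (t ∷ s ∷ v)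
    swap {s} {t} v c with P? s | P? t
    ... | no ¬s | no ¬t = trans (filter-reject P? ¬s) (trans (filter-reject P? ¬t)
                            (sym (trans (filter-reject P? ¬t) (filter-reject P? ¬s))))
    ... | yes s∈ | no ¬t = trans (filter-accept P? s∈) (trans (cong (s ∷_) (filter-reject P? ¬t))
                            (sym (trans (filter-reject P? ¬t) (filter-accept P? s∈))))
    ... | no ¬s | yes t∈ = trans (filter-reject P? ¬s) (trans (filter-accept P? t∈)
                            (sym (trans (filter-accept P? t∈) (cong (t ∷_) (filter-reject P? ¬s)))))
    ... | yes (inj₁ refl) | yes (inj₁ refl) = contradiction refl (Commute⇒≢ {s} {t} c)
    ... | yes (inj₁ refl) | yes (inj₂ refl) = contradiction c ¬ab
    ... | yes (inj₂ refl) | yes (inj₁ refl) = contradiction (Commute-sym {s} {t} c) ¬ab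
    ... | yes (inj₂ refl) | yes (inj₂ refl) = contradiction refl (Commute⇒≢ {s} {t} c)
    step : ∀ {x y} → InCtx (CommRel n) x y → restrict a b x ≡ restrict a b y
    step (ctx u _ _ v (comm s t c)) =
      trans (filter-++ P? u _) (trans (cong (restrict a b u ++_) (swap {s} {t} v c)) (sym (filter-++ P? u _)))

  restrict-commuting : ∀ {a b} (X : Word n) → All (Commute a) X → All (Commute b) X → restrict a b X ≡ []
  restrict-commuting [] [] [] = refl
  restrict-commuting {a} {b} (x ∷ X) (ca ∷ cas) (cb ∷ cbs) =
    trans (filter-reject (inPair? a b) [ Commute⇒≢ {x} (Commute-sym {a} ca) , Commute⇒≢ {x} (Commute-sym {b} cb) ])
          (restrict-commuting X cas cbs)

  Reduced-≈W : ∀ {u v : Word n} → Reduced u → u ≈W v → length u ≡ length v → Reduced v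
  Reduced-≈W ru u≈v eq z z≈v = subst (_≤ length z) eq (ru z (z≈v ◅◅ symmetric _ u≈v))

  Reduced-noSquare : ∀ {z : Word n} → Reduced z → ∀ X a V → ¬ z ≈C (X ++ a ∷ a ∷ V)
  Reduced-noSquare {z} rz X a V z≈ = ℕ.<-irrefl refl (ℕ.<-≤-trans shorter (rz (X ++ V) X++V≈z))
    where
    X++V≈z : (X ++ V) ≈W z
    X++V≈z = symmetric _ (≈C⇒≈W z≈ ◅◅ return (ctx X (a ∷ a ∷ []) [] V (square a)))
    shorter : length (X ++ V) < length z
    shorter = begin-strict
      length (X ++ V)                     ≡⟨ length-++ X ⟩
      length X + length V                 <⟨ ℕ.+-monoʳ-< (length X) (n<2+n _) ⟩
      length X + suc (suc (length V))     ≡⟨ length-++ X ⟨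
      length (X ++ a ∷ a ∷ V)             ≡⟨ ≈C-length z≈ ⟨
      length z                            ∎
      where open ℕ.≤-Reasoning

  -- A braid move changes the first letter of the restriction to {a, b}; commutation moves do not.
  FC-noBraid : ∀ {z : Word n} → Reduced z → FC z → ∀ X a b V → 3 ≤ m n a b →
               ¬ z ≈C (X ++ alt a b (m n a b) ++ V)
  FC-noBraid {z} rz fz X a b V 3≤m z≈ =
    3≤m⇒≢ {a} {b} 3≤m (sym (heads-agree k (ℕ.≤-trans (s≤s z≤n) 3≤m) same-restriction))
    where
    P? : Decidable (λ x → x ≡ a ⊎ x ≡ b)
    P? = inPair? a b
    k = m n a b
    u = X ++ alt b a k ++ V
    z≈u : z ≈W u
    z≈u = ≈C⇒≈W z≈ ◅◅ return (ctx X _ _ V (braid a b (3≤m⇒≢ {a} {b} 3≤m)))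
    u-reduced : Reduced u
    u-reduced = Reduced-≈W rz z≈u
      (trans (≈C-length z≈) (length-ctx X _ _ V (trans (length-alt a b k) (sym (length-alt b a k)))))
    u≈C : u ≈C (X ++ alt a b k ++ V)
    u≈C = fz u z u-reduced rz (symmetric _ z≈u) ε ◅◅ z≈
    same-restriction : restrict a b (alt b a k ++ V) ≡ restrict a b (alt a b k ++ V)
    same-restriction = ++-cancelˡ (restrict a b X) _ _
      (trans (sym (filter-++ P? X _)) (trans (restrict-≈C (3≤m⇒¬Commute {a} {b} 3≤m) u≈C) (filter-++ P? X _)))
    heads-agree : ∀ j → 1 ≤ j → restrict a b (alt b a j ++ V) ≡ restrict a b (alt a b j ++ V) → b ≡ a
    heads-agree (suc j) _ eq =
      ∷-injectiveˡ (trans (sym (filter-accept P? (inj₂ refl))) (trans eq (filter-accept P? (inj₁ refl))))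

  HasLength-resp : ∀ {x y : Word n} {k} → HasLength x k → x ≈W y → HasLength y k
  HasLength-resp (v , v≈x , rv , lv) x≈y = v , v≈x ◅◅ x≈y , rv , lv

  LDesc-resp : ∀ {s} {x y : Word n} → LDesc s x → x ≈W y → LDesc s y
  LDesc-resp {s} (a , b , hsx , hx , a<b) x≈y =
    a , b , HasLength-resp hsx (≈-cons s x≈y) , HasLength-resp hx x≈y , a<b

  square-≈W : ∀ s (v : Word n) → (s ∷ s ∷ v) ≈W v
  square-≈W s v = return (ctx [] (s ∷ s ∷ []) [] v (square s))

  leading-descent : ∀ {w w′ : Word n} {s} → Reduced w → w ≈C (s ∷ w′) →
                    LDesc s w × Reduced w′ × (s ∷ w) ≈W w′
  leading-descent {w} {w′} {s} rw w≈ =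
    (length w′ , length w , (w′ , symmetric _ sw≈w′ , rw′ , refl) , (w , ε , rw , refl) , ℕ.≤-reflexive (sym lw))
    , rw′ , sw≈w′
    where
    sw≈w′ : (s ∷ w) ≈W w′
    sw≈w′ = ≈-cons s (≈C⇒≈W w≈) ◅◅ square-≈W s w′
    lw : length w ≡ suc (length w′)
    lw = ≈C-length w≈
    rw′ : Reduced w′
    rw′ v v≈w′ = ℕ.≤-pred (subst (_≤ suc (length v)) lw (rw (s ∷ v) (≈-cons s v≈w′ ◅◅ symmetric _ (≈C⇒≈W w≈))))

  Reduced-∷ : ∀ {w : Word n} {t} → Reduced w → FC w → (∀ v → ¬ (t ∷ v) ≈C w) → Reduced (t ∷ w)
  Reduced-∷ {w} {t} rw fw ¬leads v v≈tw with ℕ.≤-<-connex (suc (length w)) (length v)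
  ... | inj₁ long = long
  ... | inj₂ short = contradiction (fw (t ∷ v) w tv-reduced rw tv≈w ε) (¬leads v)
    where
    tv≈w : (t ∷ v) ≈W w
    tv≈w = ≈-cons t v≈tw ◅◅ square-≈W t w
    -- v and t w have the same parity, so v is strictly shorter than w
    v<w : length v < length w
    v<w with ℕ.m≤n⇒m<n∨m≡n (ℕ.≤-pred short)
    ... | inj₁ lt = lt
    ... | inj₂ eq = contradiction (trans (cong evenℕ (sym eq)) (≈W-parity v≈tw)) (not-¬ refl)
    tv-reduced : Reduced (t ∷ v)
    tv-reduced = Reduced-≈W rw (symmetric _ tv≈w) (ℕ.≤-antisym (rw (t ∷ v) tv≈w) v<w)

  not-leading : ∀ {t s} (X R : Word n) → 3 ≤ m n t s → All (Commute t) X → All (Commute s) X →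
                ∀ v → ¬ (t ∷ v) ≈C (X ++ s ∷ R)
  not-leading {t} {s} X R 3≤m ct cs v tv≈ = 3≤m⇒≢ {t} {s} 3≤m (∷-injectiveˡ (begin
    t ∷ restrict t s v                      ≡⟨ filter-accept P? (inj₁ refl) ⟨
    restrict t s (t ∷ v)                    ≡⟨ restrict-≈C (3≤m⇒¬Commute {t} {s} 3≤m) tv≈ ⟩
    restrict t s (X ++ s ∷ R)               ≡⟨ filter-++ P? X _ ⟩
    restrict t s X ++ restrict t s (s ∷ R)  ≡⟨ cong (_++ _) (restrict-commuting X ct cs) ⟩
    restrict t s (s ∷ R)                    ≡⟨ filter-accept P? (inj₂ refl) ⟩
    s ∷ restrict t s R                      ∎))
    where
    P? : Decidable (λ x → x ≡ t ⊎ x ≡ s)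
    P? = inPair? t s
    open ≡-Reasoning

  leading-descents : ∀ X Y Z {s t} → All (Commute s) X → All (Commute t) X → All (Commute t) Y →
                     Reduced (X ++ s ∷ Y ++ t ∷ Z) →
                     LDesc s (X ++ s ∷ Y ++ t ∷ Z) × LDesc t (s ∷ X ++ s ∷ Y ++ t ∷ Z)
  leading-descents X Y Z {s} {t} cs ct ct′ rw = proj₁ first , LDesc-resp t-desc (symmetric _ (proj₂ (proj₂ first)))
    where
    first : LDesc s (X ++ s ∷ Y ++ t ∷ Z) × Reduced (X ++ Y ++ t ∷ Z) ×
            (s ∷ X ++ s ∷ Y ++ t ∷ Z) ≈W (X ++ Y ++ t ∷ Z)
    first = leading-descent rw (pull-forward s X (Y ++ t ∷ Z) cs)
    w₁≈ : (X ++ Y ++ t ∷ Z) ≈C (t ∷ X ++ Y ++ Z)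
    w₁≈ = subst₂ _≈C_ (++-assoc X Y (t ∷ Z)) (cong (t ∷_) (++-assoc X Y Z))
                 (pull-forward t (X ++ Y) Z (All.++⁺ ct ct′))
    t-desc : LDesc t (X ++ Y ++ t ∷ Z)
    t-desc = proj₁ (leading-descent (proj₁ (proj₂ first)) w₁≈)

  leftWeakStarRed-3 : ∀ {w : Word n} X Y Z {s t} → w ≡ X ++ s ∷ Y ++ t ∷ Z →
    All (Commute s) X → All (Commute t) X → All (Commute t) Y → m n s t ≡ 3 →
    Reduced w → FC w → LeftWeakStarRed s t w
  leftWeakStarRed-3 X Y Z {s} {t} refl cs ct ct′ m≡3 rw fw =
    ℕ.≤-reflexive (sym m≡3) , proj₁ descents , proj₂ descents , ¬FC
    where
    descents : LDesc s (X ++ s ∷ Y ++ t ∷ Z) × LDesc t (s ∷ X ++ s ∷ Y ++ t ∷ Z)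
    descents = leading-descents X Y Z cs ct ct′ rw
    m′≡3 : m n t s ≡ 3
    m′≡3 = trans (mℕ-sym n (toℕ t) (toℕ s)) m≡3
    tw≈ : (t ∷ X ++ s ∷ Y ++ t ∷ Z) ≈C (X ++ alt t s (m n t s) ++ Y ++ Z)
    tw≈ rewrite m′≡3 = commute-past t X _ ct ◅◅ ≈-prefix X (≈-cons t (≈-cons s (pull-forward t Y Z ct′)))
    ¬FC : ¬ FC (t ∷ X ++ s ∷ Y ++ t ∷ Z)
    ¬FC ftw = FC-noBraid (Reduced-∷ rw fw (not-leading X _ 3≤m ct cs)) ftw X t s (Y ++ Z) 3≤m tw≈
      where 3≤m = ℕ.≤-reflexive (sym m′≡3)

  leftWeakStarRed-4 : ∀ {w : Word n} X Y Z U {s t} → w ≡ X ++ s ∷ Y ++ t ∷ Z ++ s ∷ U →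
    All (Commute s) X → All (Commute t) X → All (Commute t) Y → All (Commute s) Y → All (Commute s) Z →
    m n s t ≡ 4 → Reduced w → FC w → LeftWeakStarRed s t w
  leftWeakStarRed-4 X Y Z U {s} {t} refl cs ct ct′ cs′ cs′′ m≡4 rw fw =
    ℕ.≤-trans (ℕ.n≤1+n 3) (ℕ.≤-reflexive (sym m≡4)) , proj₁ descents , proj₂ descents , ¬FC
    where
    descents : LDesc s (X ++ s ∷ Y ++ t ∷ Z ++ s ∷ U) × LDesc t (s ∷ X ++ s ∷ Y ++ t ∷ Z ++ s ∷ U)
    descents = leading-descents X Y (Z ++ s ∷ U) cs ct ct′ rw
    m′≡4 : m n t s ≡ 4
    m′≡4 = trans (mℕ-sym n (toℕ t) (toℕ s)) m≡4
    tw≈ : (t ∷ X ++ s ∷ Y ++ t ∷ Z ++ s ∷ U) ≈C (X ++ alt t s (m n t s) ++ Y ++ Z ++ U)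
    tw≈ rewrite m′≡4 =
      commute-past t X _ ct
      ◅◅ ≈-prefix X (≈-cons t (≈-cons s (≈-prefix Y (≈-cons t (pull-forward s Z U cs′′)))))
      ◅◅ ≈-prefix X (≈-cons t (≈-cons s (pull-forward t Y (s ∷ Z ++ U) ct′
                                         ◅◅ ≈-cons t (pull-forward s Y (Z ++ U) cs′))))
    ¬FC : ¬ FC (t ∷ X ++ s ∷ Y ++ t ∷ Z ++ s ∷ U)
    ¬FC ftw = FC-noBraid (Reduced-∷ rw fw (not-leading X _ 3≤m ct cs)) ftw X t s (Y ++ Z ++ U) 3≤m tw≈
      where 3≤m = ℕ.≤-trans (ℕ.n≤1+n 3) (ℕ.≤-reflexive (sym m′≡4))

module Heap (n : ℕ) where

  Entry : Set
  Entry = Gen n × ℕ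

  label : Entry → Gen n
  label = proj₁

  row : Entry → ℕ
  row = proj₂

  WellRowed : List Entry → Set
  WellRowed L = ∀ A e B → L ≡ A ++ e ∷ B → row e ≡ suc (maxRowAbove (label e) A)

  WellRowed-[] : WellRowed []
  WellRowed-[] [] _ _ ()
  WellRowed-[] (_ ∷ _) _ _ ()

  WellRowed-snoc : ∀ acc x → WellRowed acc → WellRowed (acc ++ (x , suc (maxRowAbove x acc)) ∷ [])
  WellRowed-snoc acc x wr A e B eq with initLast B
  ... | [] with refl , refl ← ∷ʳ-injective acc A eq = refl
  ... | B′ ∷ʳ′ b = wr A e B′ (∷ʳ-injectiveˡ acc (A ++ e ∷ B′) (trans eq (sym (++-assoc A (e ∷ B′) (b ∷ [])))))

  WellRowed-heapGo : ∀ acc (xs : Word n) → WellRowed acc → WellRowed (heapGo acc xs)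
  WellRowed-heapGo acc [] wr = wr
  WellRowed-heapGo acc (x ∷ xs) wr = WellRowed-heapGo _ xs (WellRowed-snoc acc x wr)

  labels-heapGo : ∀ acc (xs : Word n) → map label (heapGo acc xs) ≡ map label acc ++ xs
  labels-heapGo acc [] = sym (++-identityʳ (map label acc))
  labels-heapGo acc (x ∷ xs) = begin
    map label (heapGo (acc ++ (x , _) ∷ []) xs) ≡⟨ labels-heapGo _ xs ⟩
    map label (acc ++ (x , _) ∷ []) ++ xs       ≡⟨ cong (_++ xs) (map-++ label acc _) ⟩
    (map label acc ++ x ∷ []) ++ xs             ≡⟨ ++-assoc (map label acc) (x ∷ []) xs ⟩
    map label acc ++ x ∷ xs                     ∎
    where open ≡-Reasoning

  noncommᵇ-true : ∀ x y → m n x y ≢ 2 → noncommᵇ x y ≡ true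
  noncommᵇ-true x y m≢2 with m n x y ≡ᵇ 2 in eq
  ... | true  = contradiction (≡ᵇ-sound _ _ eq) m≢2
  ... | false = refl

  noncommᵇ-sound : ∀ x y → noncommᵇ x y ≡ true → m n x y ≢ 2
  noncommᵇ-sound x y nc m≡2 rewrite m≡2 = contradiction nc λ ()

  maxRowAbove-≥ : ∀ x (A : List Entry) {e} → e ∈ A → noncommᵇ x (label e) ≡ true → row e ≤ maxRowAbove x A
  maxRowAbove-≥ x (a ∷ A) (here refl) nc rewrite nc = ℕ.m≤m⊔n (row a) _
  maxRowAbove-≥ x (a ∷ A) (there e∈A) nc with noncommᵇ x (label a)
  ... | true  = ℕ.≤-trans (maxRowAbove-≥ x A e∈A nc) (ℕ.m≤n⊔m (row a) _)
  ... | false = maxRowAbove-≥ x A e∈A nc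

  maxRowAbove-attained : ∀ x (A : List Entry) →
    maxRowAbove x A ≡ 0 ⊎ Any (λ e → noncommᵇ x (label e) ≡ true × row e ≡ maxRowAbove x A) A
  maxRowAbove-attained x [] = inj₁ refl
  maxRowAbove-attained x (a ∷ A) with noncommᵇ x (label a) in nc
  ... | false = Sum.map₂ there (maxRowAbove-attained x A)
  ... | true with ℕ.⊔-sel (row a) (maxRowAbove x A)
  ...   | inj₁ eq = inj₂ (here (nc , sym eq))
  ...   | inj₂ eq = Sum.map (trans eq) (there ∘ Any.map (Product.map₂ (λ r → trans r (sym eq))))
                      (maxRowAbove-attained x A)

  Before⇒row< : ∀ {L} → WellRowed L → ∀ {e₁ e₂} → Before L e₁ e₂ →
                noncommᵇ (label e₂) (label e₁) ≡ true → row e₁ < row e₂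
  Before⇒row< wr {e₁} {e₂} (A , B , C , eq) nc =
    subst (row e₁ <_) (sym (wr (A ++ e₁ ∷ B) e₂ C (trans eq (sym (++-assoc A (e₁ ∷ B) (e₂ ∷ C))))))
      (s≤s (maxRowAbove-≥ (label e₂) (A ++ e₁ ∷ B) (Any.++⁺ʳ A (here refl)) nc))


module HeapOf {n : ℕ} (w : Word n) (w-reduced : Reduced w) (w-fc : FC w) where
  open Words n
  open Heap n

  heap : List Entry
  heap = heapRows w

  wellRowed : WellRowed heap
  wellRowed = WellRowed-heapGo [] w WellRowed-[]

  At : ℕ → ℕ → Entry → Set
  At r x e = toℕ (label e) ≡ x × row e ≡ r

  InRow : ℕ → ℕ → Set
  InRow r x = Any (At r x) heap

  InRow? : ∀ r x → Dec (InRow r x)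
  InRow? r x = Any.any? (λ e → (toℕ (label e) ℕ.≟ x) ×-dec (row e ℕ.≟ r)) heap

  InRow-entry : ∀ {e} → e ∈ heap → InRow (row e) (toℕ (label e))
  InRow-entry = Any.map λ { refl → refl , refl }

  ¬InRow-0 : ∀ {x} → ¬ InRow 0 x
  ¬InRow-0 p with A , e , B , eq , (_ , r≡0) ← Any-split heap p =
    contradiction (trans (sym (wellRowed A e B eq)) r≡0) ℕ.1+n≢0

  InRow-bound : ∀ {r x} → InRow r x → x ≤ n
  InRow-bound p with _ , e , _ , _ , (refl , _) ← Any-split heap p = ℕ.≤-pred (toℕ<n (label e))

  Before-near⇒row< : ∀ {e₁ e₂} → Before heap e₁ e₂ → Near (toℕ (label e₂)) (toℕ (label e₁)) → row e₁ < row e₂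
  Before-near⇒row< {e₁} {e₂} e₁<e₂ near =
    Before⇒row< wellRowed e₁<e₂ (noncommᵇ-true (label e₂) (label e₁) (Near⇒mℕ≢2 n near))

  Before-same⇒row< : ∀ {e₁ e₂} → Before heap e₁ e₂ → toℕ (label e₁) ≡ toℕ (label e₂) → row e₁ < row e₂
  Before-same⇒row< e₁<e₂ eq = Before-near⇒row< e₁<e₂ (inj₁ (sym eq))

  w-split₂ : ∀ {A x B y C} → heap ≡ A ++ x ∷ B ++ y ∷ C →
             w ≡ map label A ++ label x ∷ map label B ++ label y ∷ map label C
  w-split₂ {A} {x} {B} {y} {C} eq = begin
    w                                                 ≡⟨ labels-heapGo [] w ⟨
    map label heap                                    ≡⟨ cong (map label) eq ⟩
    map label (A ++ x ∷ B ++ y ∷ C)                   ≡⟨ map-++ label A _ ⟩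
    map label A ++ label x ∷ map label (B ++ y ∷ C)   ≡⟨ cong (λ q → map label A ++ label x ∷ q) (map-++ label B _) ⟩
    map label A ++ label x ∷ map label B ++ label y ∷ map label C ∎
    where open ≡-Reasoning

  w-split₃ : ∀ {A x B₁ y B₂ z C} → heap ≡ A ++ x ∷ (B₁ ++ y ∷ B₂) ++ z ∷ C →
    w ≡ map label A ++ label x ∷ map label B₁ ++ label y ∷ map label B₂ ++ label z ∷ map label C
  w-split₃ {A} {x} {B₁} {y} {B₂} {z} {C} eq = trans (w-split₂ eq)
    (cong (λ q → map label A ++ label x ∷ q)
      (trans (cong (_++ label z ∷ map label C) (map-++ label B₁ (y ∷ B₂)))
             (++-assoc (map label B₁) (label y ∷ map label B₂) (label z ∷ map label C))))

  commuting-segment : ∀ g (B : List Entry) → (∀ {e} → e ∈ B → ¬ Near (toℕ g) (toℕ (label e))) →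
                      All (Commute g) (map label B)
  commuting-segment g B far = All.map⁺ (All.tabulate λ {e} e∈B →
    decidable-stable (m n g (label e) ℕ.≟ 2) λ ¬c → far e∈B (mℕ≢2⇒Near n (toℕ g) (toℕ (label e)) ¬c))

  ¬InRow-adjacent : ∀ {r x} → InRow r x → ¬ InRow r (suc x)
  ¬InRow-adjacent {r} {x} p q with Any-order heap p q
  ... | inj₁ (_ , _ , (l₁ , r₁) , (l₂ , r₂) , e₁<e₂) =
    ℕ.<-irrefl (trans r₁ (sym r₂)) (Before-near⇒row< e₁<e₂ (inj₂ (inj₂ (trans (cong suc l₁) (sym l₂)))))
  ... | inj₂ (inj₁ (_ , _ , (l₁ , r₁) , (l₂ , r₂) , e₁<e₂)) =
    ℕ.<-irrefl (trans r₁ (sym r₂)) (Before-near⇒row< e₁<e₂ (inj₂ (inj₁ (trans (cong suc l₂) (sym l₁)))))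
  ... | inj₂ (inj₂ both) with _ , (l₁ , _) , (l₂ , _) ← Any.satisfied both = ℕ.1+n≢n (trans (sym l₂) l₁)

  -- Between two occurrences of a letter in consecutive rows every letter commutes with it,
  -- so w would contain a square up to commutation.
  ¬InRow-successive : ∀ {r x} → InRow r x → ¬ InRow (suc r) x
  ¬InRow-successive {r} {x} p q with Any-order heap p q
  ... | inj₂ (inj₂ both) with _ , (_ , r₁) , (_ , r₂) ← Any.satisfied both = ℕ.1+n≢n (trans (sym r₂) r₁)
  ¬InRow-successive {r} {x} p q | inj₂ (inj₁ (_ , _ , (l₁ , r₁) , (l₂ , r₂) , e₂<e₁)) =
    ℕ.<-irrefl refl (ℕ.<-trans (subst₂ _<_ r₁ r₂ (Before-near⇒row< e₂<e₁ (inj₁ (trans l₂ (sym l₁))))) (ℕ.n<1+n r))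
  ¬InRow-successive {r} {x} p q | inj₁ (e₁ , e₂ , (l₁ , r₁) , (l₂ , r₂) , A , B , C , eq) =
    Reduced-noSquare w-reduced (map label A ++ map label B) (label e₁) (map label C)
      (subst₂ _≈C_ (sym w≡) (sym (++-assoc (map label A) _ _))
        (≈-prefix (map label A) (commute-past (label e₁) (map label B) _ between)))
    where
    w≡ : w ≡ map label A ++ label e₁ ∷ map label B ++ label e₁ ∷ map label C
    w≡ = trans (w-split₂ eq) (cong (λ g → map label A ++ label e₁ ∷ map label B ++ g ∷ map label C)
                                   (toℕ-injective (trans l₂ (sym l₁))))
    between : All (Commute (label e₁)) (map label B)
    between = commuting-segment (label e₁) B λ {e} e∈B near →
      let e₁<e , e<e₂ = Before-around eq e∈B in
      ℕ.<-irrefl refl (ℕ.<-≤-trans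
        (subst (row e <_) r₂ (Before-near⇒row< e<e₂ (subst (λ z → Near z _) (trans l₁ (sym l₂)) near)))
        (subst (_< row e) r₁ (Before-near⇒row< e₁<e (Near-sym near))))

  covered : ∀ {r x} → InRow (suc (suc r)) x → InRow (suc r) (suc x) ⊎ ∃[ y ] (x ≡ suc y × InRow (suc r) y)
  covered {r} {x} p with Any-split heap p
  ... | A , e , B , eq , (l , r≡) with maxRowAbove-attained (label e) A
  ...   | inj₁ max≡0 = contradiction (trans (sym max≡0) (ℕ.suc-injective (trans (sym (wellRowed A e B eq)) r≡))) ℕ.0≢1+n
  ...   | inj₂ q with A₁ , e′ , A₂ , refl , (nc , r′≡) ← Any-split A q =
    cover (mℕ≢2⇒Near n (toℕ (label e)) (toℕ (label e′)) (noncommᵇ-sound (label e) (label e′) nc))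
    where
    e′-InRow : InRow (suc r) (toℕ (label e′))
    e′-InRow = subst (λ k → InRow k (toℕ (label e′)))
                 (trans r′≡ (ℕ.suc-injective (trans (sym (wellRowed _ e B eq)) r≡)))
                 (InRow-entry (∈-split {X = A₁} {Y = A₂ ++ e ∷ B} (trans eq (++-assoc A₁ (e′ ∷ A₂) (e ∷ B)))))
    cover : Near (toℕ (label e)) (toℕ (label e′)) → InRow (suc r) (suc x) ⊎ ∃[ y ] (x ≡ suc y × InRow (suc r) y)
    cover (inj₁ same) = contradiction p (¬InRow-successive (subst (InRow (suc r)) (trans (sym same) l) e′-InRow))
    cover (inj₂ (inj₁ up)) = inj₁ (subst (InRow (suc r)) (trans (sym up) (cong suc l)) e′-InRow)
    cover (inj₂ (inj₂ down)) = inj₂ (toℕ (label e′) , trans (sym l) (sym down) , e′-InRow)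

  SoleNeighbour : ℕ → ℕ → ℕ → Set
  SoleNeighbour r a b = ∀ c → InRow r c → Adj a c → c ≡ b

  -- An entry strictly between eP and eR whose label is near a lies in row r + 1, so it is a second
  -- copy of b in that row.
  commute-around : ∀ {r a b A eP B₁ eQ B₂ eR C} → heap ≡ A ++ eP ∷ (B₁ ++ eQ ∷ B₂) ++ eR ∷ C →
    At r a eP → At (suc r) b eQ → At (suc (suc r)) a eR → SoleNeighbour (suc r) a b →
    All (Commute (label eP)) (map label B₁) × All (Commute (label eP)) (map label B₂)
  commute-around {r} {a} {b} {A} {eP} {B₁} {eQ} {B₂} {eR} {C} eq (lP , rP) (lQ , rQ) (lR , rR) sole =
    commuting-segment (label eP) B₁ (λ {e} e∈B₁ near →
      let e<eQ = proj₂ (Before-around eq₁ e∈B₁)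
          l , r≡ = copy-of-eQ (Any.++⁺ˡ e∈B₁) near
      in ℕ.<-irrefl (trans r≡ (sym rQ)) (Before-same⇒row< e<eQ (trans l (sym lQ)))) ,
    commuting-segment (label eP) B₂ (λ {e} e∈B₂ near →
      let eQ<e = proj₁ (Before-around eq₂ e∈B₂)
          l , r≡ = copy-of-eQ (Any.++⁺ʳ B₁ (there e∈B₂)) near
      in ℕ.<-irrefl (trans rQ (sym r≡)) (Before-same⇒row< eQ<e (trans lQ (sym l))))
    where
    eq₁ : heap ≡ A ++ eP ∷ B₁ ++ eQ ∷ (B₂ ++ eR ∷ C)
    eq₁ = trans eq (cong (λ q → A ++ eP ∷ q) (++-assoc B₁ (eQ ∷ B₂) (eR ∷ C)))
    eq₂ : heap ≡ (A ++ eP ∷ B₁) ++ eQ ∷ B₂ ++ eR ∷ C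
    eq₂ = trans eq₁ (sym (++-assoc A (eP ∷ B₁) _))
    copy-of-eQ : ∀ {e} → e ∈ B₁ ++ eQ ∷ B₂ → Near (toℕ (label eP)) (toℕ (label e)) → At (suc r) b e
    copy-of-eQ {e} e∈B near = label≡b (subst (λ z → Near z _) lP near) , row≡
      where
      eP<e : Before heap eP e
      eP<e = proj₁ (Before-around eq e∈B)
      e<eR : Before heap e eR
      e<eR = proj₂ (Before-around eq e∈B)
      row≡ : row e ≡ suc r
      row≡ = m<n<2+m⇒n≡1+m (subst (_< row e) rP (Before-near⇒row< eP<e (Near-sym near)))
                         (subst (row e <_) rR (Before-near⇒row< e<eR (subst (λ z → Near z _) (trans lP (sym lR)) near)))
      e-InRow : InRow (suc r) (toℕ (label e))
      e-InRow = subst (λ k → InRow k _) row≡ (InRow-entry (Before⇒∈ʳ eP<e))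
      label≡b : Near a (toℕ (label e)) → toℕ (label e) ≡ b
      label≡b (inj₁ same) = contradiction (subst (InRow (suc r)) (sym same) e-InRow)
                              (¬InRow-successive (subst₂ InRow rP lP (InRow-entry (∈-split {X = A} eq))))
      label≡b (inj₂ adj) = sole _ e-InRow adj

  between-rows : ∀ {r a b A eP B eR C} → heap ≡ A ++ eP ∷ B ++ eR ∷ C → At r a eP → At (suc (suc r)) a eR →
                 Adj a b → InRow (suc r) b → Any (At (suc r) b) B
  between-rows {r} {a} {b} {eP = eP} {eR = eR} eq (lP , rP) (lR , rR) adj q = Any-between eq q ¬before ¬P ¬R ¬after
    where
    ¬before : ∀ {e} → At (suc r) b e → ¬ Before heap e eP
    ¬before (l , r≡) e<eP =
      ℕ.<-asym (ℕ.n<1+n r) (subst₂ _<_ r≡ rP (Before-near⇒row< e<eP (subst₂ Near (sym lP) (sym l) (inj₂ adj))))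
    ¬P : ¬ At (suc r) b eP
    ¬P (_ , r≡) = ℕ.1+n≢n (trans (sym r≡) rP)
    ¬R : ¬ At (suc r) b eR
    ¬R (_ , r≡) = ℕ.1+n≢n (trans (sym rR) r≡)
    ¬after : ∀ {e} → At (suc r) b e → ¬ Before heap eR e
    ¬after (l , r≡) eR<e =
      ℕ.<-asym (ℕ.n<1+n (suc r))
        (subst₂ _<_ rR r≡ (Before-near⇒row< eR<e (subst₂ Near (sym l) (sym lR) (inj₂ (Adj-sym adj)))))

  record Zigzag (r a b : ℕ) : Set where
    field
      A B₁ B₂ C : List Entry
      e₁ e₂ e₃ : Entry
      split : heap ≡ A ++ e₁ ∷ (B₁ ++ e₂ ∷ B₂) ++ e₃ ∷ C
      at₁ : At r a e₁
      at₂ : At (suc r) b e₂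
      at₃ : At (suc (suc r)) a e₃

  zigzag : ∀ {r a b} → InRow r a → InRow (suc r) b → InRow (suc (suc r)) a → Adj a b → Zigzag r a b
  zigzag {r} {a} {b} p q p′ adj with Any-order heap p p′
  ... | inj₂ (inj₂ both) with _ , (_ , r₁) , (_ , r₂) ← Any.satisfied both =
    contradiction (trans (sym r₁) r₂) (ℕ.<⇒≢ (n<2+n r))
  ... | inj₂ (inj₁ (_ , _ , (l₁ , r₁) , (l₂ , r₂) , e<e′)) =
    contradiction (subst₂ _<_ r₁ r₂ (Before-same⇒row< e<e′ (trans l₁ (sym l₂)))) (ℕ.<-asym (n<2+n r))
  ... | inj₁ (eP , eR , atP , atR , A , B , C , eq)
    with B₁ , eQ , B₂ , refl , atQ ← Any-split B (between-rows eq atP atR adj q) =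
    record { A = A ; B₁ = B₁ ; B₂ = B₂ ; C = C ; e₁ = eP ; e₂ = eQ ; e₃ = eR
           ; split = eq ; at₁ = atP ; at₂ = atQ ; at₃ = atR }

  -- Everything between the three entries commutes with a, so w is commutation equivalent to a
  -- word containing a b a.
  ¬braid3 : ∀ {r a b} → InRow r a → InRow (suc r) b → InRow (suc (suc r)) a → Adj a b →
            mℕ n a b ≡ 3 → ¬ SoleNeighbour (suc r) a b
  ¬braid3 {r} {a} {b} p q p′ adj m≡3 sole =
    FC-noBraid w-reduced w-fc (mA ++ mB₁) ga gb (mB₂ ++ mC) (ℕ.≤-reflexive (sym m≡3′))
      (subst (w ≈C_) (sym (++-assoc mA mB₁ _)) w≈)
    where
    open Zigzag (zigzag p q p′ adj)
    mA = map label A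
    mB₁ = map label B₁
    mB₂ = map label B₂
    mC = map label C
    ga = label e₁
    gb = label e₂
    m≡3′ : m n ga gb ≡ 3
    m≡3′ = subst₂ (λ x y → mℕ n x y ≡ 3) (sym (proj₁ at₁)) (sym (proj₁ at₂)) m≡3
    commuting : All (Commute ga) mB₁ × All (Commute ga) mB₂
    commuting = commute-around split at₁ at₂ at₃ sole
    w≡ : w ≡ mA ++ ga ∷ mB₁ ++ gb ∷ mB₂ ++ ga ∷ mC
    w≡ = trans (w-split₃ split)
      (cong (λ g → mA ++ ga ∷ mB₁ ++ gb ∷ mB₂ ++ g ∷ mC) (toℕ-injective (trans (proj₁ at₃) (sym (proj₁ at₁)))))
    w≈ : w ≈C (mA ++ mB₁ ++ alt ga gb (m n ga gb) ++ mB₂ ++ mC)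
    w≈ rewrite m≡3′ = subst (_≈C (mA ++ mB₁ ++ ga ∷ gb ∷ ga ∷ mB₂ ++ mC)) (sym w≡)
      (≈-prefix mA (commute-past ga mB₁ _ (proj₁ commuting)
                    ◅◅ ≈-prefix mB₁ (≈-cons ga (≈-cons gb (pull-forward ga mB₂ mC (proj₂ commuting))))))

  ¬braid4 : ∀ {r a b} → InRow r b → InRow (suc r) a → InRow (suc (suc r)) b → InRow (suc (suc (suc r))) a →
            Adj a b → mℕ n b a ≡ 4 → SoleNeighbour (suc r) b a → ¬ SoleNeighbour (suc (suc r)) a b
  ¬braid4 {r} {a} {b} p q p′ q′ adj m≡4 sole₁ sole₂ = with-fourth (Any-split C fourth)
    where
    open Zigzag (zigzag p q p′ (Adj-sym adj))
    fourth : Any (At (suc (suc (suc r))) a) C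
    fourth = Any-after (trans split (sym (++-assoc A (e₁ ∷ B₁ ++ e₂ ∷ B₂) _))) q′
      (λ { (l , r≡) e<e₃ → ℕ.<-asym (ℕ.n<1+n _) (subst₂ _<_ r≡ (proj₂ at₃)
             (Before-near⇒row< e<e₃ (subst₂ Near (sym (proj₁ at₃)) (sym l) (inj₂ (Adj-sym adj))))) })
      (λ (_ , r≡) → ℕ.1+n≢n (trans (sym r≡) (proj₂ at₃)))
    mA = map label A
    mB₁ = map label B₁
    mB₂ = map label B₂
    gb = label e₁
    ga = label e₂
    m≡4′ : m n gb ga ≡ 4
    m≡4′ = subst₂ (λ x y → mℕ n x y ≡ 4) (sym (proj₁ at₁)) (sym (proj₁ at₂)) m≡4
    with-fourth : ∃[ C₁ ] ∃[ e₄ ] ∃[ C₂ ] (C ≡ C₁ ++ e₄ ∷ C₂ × At (suc (suc (suc r))) a e₄) → ⊥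
    with-fourth (C₁ , e₄ , C₂ , C≡ , at₄) =
      FC-noBraid w-reduced w-fc (mA ++ mB₁) gb ga (mB₂ ++ mC₁ ++ mC₂) (ℕ.≤-trans (ℕ.n≤1+n 3) (ℕ.≤-reflexive (sym m≡4′)))
        (subst (w ≈C_) (sym (++-assoc mA mB₁ _)) w≈)
      where
      mC₁ = map label C₁
      mC₂ = map label C₂
      split₁ : heap ≡ A ++ e₁ ∷ (B₁ ++ e₂ ∷ B₂) ++ e₃ ∷ C₁ ++ e₄ ∷ C₂
      split₁ = subst (λ X → heap ≡ A ++ e₁ ∷ (B₁ ++ e₂ ∷ B₂) ++ e₃ ∷ X) C≡ split
      split₂ : heap ≡ (A ++ e₁ ∷ B₁) ++ e₂ ∷ (B₂ ++ e₃ ∷ C₁) ++ e₄ ∷ C₂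
      split₂ = trans split₁ (begin
        A ++ e₁ ∷ (B₁ ++ e₂ ∷ B₂) ++ e₃ ∷ C₁ ++ e₄ ∷ C₂   ≡⟨ cong (λ X → A ++ e₁ ∷ X) (++-assoc B₁ (e₂ ∷ B₂) _) ⟩
        A ++ e₁ ∷ B₁ ++ e₂ ∷ B₂ ++ e₃ ∷ C₁ ++ e₄ ∷ C₂     ≡⟨ cong (λ X → A ++ e₁ ∷ B₁ ++ e₂ ∷ X) (++-assoc B₂ (e₃ ∷ C₁) _) ⟨
        A ++ e₁ ∷ B₁ ++ e₂ ∷ (B₂ ++ e₃ ∷ C₁) ++ e₄ ∷ C₂   ≡⟨ ++-assoc A (e₁ ∷ B₁) _ ⟨
        (A ++ e₁ ∷ B₁) ++ e₂ ∷ (B₂ ++ e₃ ∷ C₁) ++ e₄ ∷ C₂ ∎)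
        where open ≡-Reasoning
      commuting₁ : All (Commute gb) mB₁ × All (Commute gb) mB₂
      commuting₁ = commute-around split₁ at₁ at₂ at₃ sole₁
      commuting₂ : All (Commute ga) mB₂ × All (Commute ga) mC₁
      commuting₂ = commute-around split₂ at₂ at₃ at₄ sole₂
      w≡ : w ≡ mA ++ gb ∷ mB₁ ++ ga ∷ mB₂ ++ gb ∷ mC₁ ++ ga ∷ mC₂
      w≡ = trans (w-split₃ split₁)
        (cong₂ (λ g h → mA ++ gb ∷ mB₁ ++ ga ∷ mB₂ ++ g ∷ h) (toℕ-injective (trans (proj₁ at₃) (sym (proj₁ at₁))))
          (trans (map-++ label C₁ (e₄ ∷ C₂)) (cong (λ h → mC₁ ++ h ∷ mC₂) (toℕ-injective (trans (proj₁ at₄) (sym (proj₁ at₂)))))))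
      w≈ : w ≈C (mA ++ mB₁ ++ alt gb ga (m n gb ga) ++ mB₂ ++ mC₁ ++ mC₂)
      w≈ rewrite m≡4′ = subst (_≈C (mA ++ mB₁ ++ gb ∷ ga ∷ gb ∷ ga ∷ mB₂ ++ mC₁ ++ mC₂)) (sym w≡)
        (≈-prefix mA (commute-past gb mB₁ _ (proj₁ commuting₁))
         ◅◅ ≈-prefix mA (≈-prefix mB₁ (≈-cons gb (≈-cons ga (≈-prefix mB₂ (≈-cons gb
              (pull-forward ga mC₁ mC₂ (proj₂ commuting₂)))))))
         ◅◅ ≈-prefix mA (≈-prefix mB₁ (≈-cons gb (≈-cons ga
              (pull-forward gb mB₂ (ga ∷ mC₁ ++ mC₂) (proj₂ commuting₁)
               ◅◅ ≈-cons gb (pull-forward ga mB₂ (mC₁ ++ mC₂) (proj₁ commuting₂)))))))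

  row-positive : ∀ {e} → e ∈ heap → 1 ≤ row e
  row-positive e∈ with A , B , eq ← ∈-∃++ e∈ rewrite wellRowed A _ B eq = s≤s z≤n

  commute-before-row1 : ∀ {X x R} → heap ≡ X ++ x ∷ R → row x ≡ 1 → All (Commute (label x)) (map label X)
  commute-before-row1 {X} {x} eq r≡1 = commuting-segment (label x) X λ {e} e∈X near →
    let e<x = Before-prefix eq e∈X in
    ℕ.<-irrefl refl (ℕ.<-≤-trans (subst (row e <_) r≡1 (Before-near⇒row< e<x near)) (row-positive (Before⇒∈ˡ e<x)))

  -- A neighbour of t above the row-2 entry eT lies in row 1, so it is a second copy of s there.
  commute-before-row2 : ∀ {eT t s eS} (X : List Entry) → At 2 t eT → At 1 s eS → SoleNeighbour 1 t s →
    (∀ {e} → e ∈ X → Before heap e eT × (Before heap e eS ⊎ Before heap eS e)) → All (Commute (label eT)) (map label X)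
  commute-before-row2 {eT} {t} {s} {eS} X (lT , rT) (lS , rS) sole position =
    commuting-segment (label eT) X λ e∈X near → not-near e∈X (subst (λ z → Near z _) lT near)
    where
    not-near : ∀ {e} → e ∈ X → ¬ Near t (toℕ (label e))
    not-near {e} e∈X near = conclude near
      where
      e<eT : Before heap e eT
      e<eT = proj₁ (position e∈X)
      row≡1 : row e ≡ 1
      row≡1 = ℕ.≤-antisym (ℕ.≤-pred (subst (row e <_) rT (Before-near⇒row< e<eT (subst (λ z → Near z _) (sym lT) near))))
                          (row-positive (Before⇒∈ˡ e<eT))
      e-InRow : InRow 1 (toℕ (label e))
      e-InRow = subst (λ k → InRow k _) row≡1 (InRow-entry (Before⇒∈ˡ e<eT))
      copy-of-eS : toℕ (label e) ≡ s → ¬ (Before heap e eS ⊎ Before heap eS e)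
      copy-of-eS ls (inj₁ e<eS) = ℕ.<-irrefl (trans row≡1 (sym rS)) (Before-same⇒row< e<eS (trans ls (sym lS)))
      copy-of-eS ls (inj₂ eS<e) = ℕ.<-irrefl (trans rS (sym row≡1)) (Before-same⇒row< eS<e (trans lS (sym ls)))
      conclude : ¬ Near t (toℕ (label e))
      conclude (inj₁ same) = ¬InRow-successive (subst (InRow 1) (sym same) e-InRow)
                                                (subst₂ InRow rT lT (InRow-entry (Before⇒∈ʳ e<eT)))
      conclude (inj₂ adj) = copy-of-eS (sole _ e-InRow adj) (proj₂ (position e∈X))

  SameRow⇒≢ : Entry → Entry → Set
  SameRow⇒≢ e₁ e₂ = row e₁ ≡ row e₂ → label e₁ ≢ label e₂

  heap-pairs : AllPairs SameRow⇒≢ heap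
  heap-pairs = pairs [] heap refl
    where
    pairs : ∀ X Y → heap ≡ X ++ Y → AllPairs SameRow⇒≢ Y
    pairs X [] _ = []
    pairs X (y ∷ Y) eq = All.tabulate later ∷ pairs (X ++ y ∷ []) Y (trans eq (sym (++-assoc X (y ∷ []) Y)))
      where
      later : ∀ {z} → z ∈ Y → SameRow⇒≢ y z
      later z∈Y same-row same-label with B , C , refl ← ∈-∃++ z∈Y =
        ℕ.<-irrefl same-row (Before-same⇒row< (X , B , C , eq) (cong toℕ same-label))

  rowLabels-unique : ∀ r → Unique (rowLabels w r)
  rowLabels-unique r =
    AllPairs.map⁺ (distinct (All.map (ℕ.≡ᵇ⇒≡ _ _) (All.all-filter P? heap)) (AllPairs.filter⁺ P? heap-pairs))
    where
    P? : Decidable (λ e → T (row e ≡ᵇ r))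
    P? e = T? (row e ≡ᵇ r)
    distinct : ∀ {F} → All (λ e → row e ≡ r) F → AllPairs SameRow⇒≢ F →
               AllPairs (λ e₁ e₂ → label e₁ ≢ label e₂) F
    distinct [] [] = []
    distinct (r₁ ∷ rs) (p ∷ ps) = All.zipWith (λ (rᵢ , pᵢ) → pᵢ (trans r₁ (sym rᵢ))) (rs , p) ∷ distinct rs ps

  ∈rowLabels⇒InRow : ∀ {r} g → g ∈ rowLabels w r → InRow r (toℕ g)
  ∈rowLabels⇒InRow {r} g g∈ with e , e∈ , refl , t ← ∈-map∘filter⁻ label (λ e → T? (row e ≡ᵇ r)) g∈ =
    subst (λ k → InRow k (toℕ (label e))) (ℕ.≡ᵇ⇒≡ _ _ t) (InRow-entry e∈)

  InRow⇒∈rowLabels : ∀ {r} g → InRow r (toℕ g) → g ∈ rowLabels w r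
  InRow⇒∈rowLabels {r} g p with _ , e , _ , eq , (l , r≡) ← Any-split heap p =
    ∈-map∘filter⁺ label (λ e → T? (row e ≡ᵇ r)) (e , ∈-split eq , toℕ-injective (sym l) , ℕ.≡⇒≡ᵇ _ _ r≡)

  ∈-gens : ∀ (q : ℕ → Bool) (g : Gen n) → g ∈ filterᵇ (q ∘ toℕ) (allGens n) ⇔ q (toℕ g) ≡ true
  ∈-gens q g = mk⇔ (λ g∈ → Equivalence.to T-≡ (proj₂ (∈-filter⁻ (T? ∘ q ∘ toℕ) g∈)))
                   (λ qg → ∈-filter⁺ (T? ∘ q ∘ toℕ) (∈-allFin g) (Equivalence.from T-≡ qg))

  RowIs⇒InRow : ∀ {r} (q : ℕ → Bool) → RowIs w r (filterᵇ (q ∘ toℕ) (allGens n)) →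
                ∀ x → x ≤ n → q x ≡ true → InRow r x
  RowIs⇒InRow q ρ x x≤n qx = subst (InRow _) (toℕ-fromℕ< (s≤s x≤n))
    (∈rowLabels⇒InRow g (∈-resp-↭ (↭-sym ρ)
      (Equivalence.from (∈-gens q g) (subst (λ y → q y ≡ true) (sym (toℕ-fromℕ< (s≤s x≤n))) qx))))
    where g = fromℕ< (s≤s x≤n)

  InRow⇒RowIs : ∀ r (q : ℕ → Bool) → (∀ {x} → InRow r x → q x ≡ true) → (∀ x → x ≤ n → q x ≡ true → InRow r x) →
                RowIs w r (filterᵇ (q ∘ toℕ) (allGens n))
  InRow⇒RowIs r q sound complete =
    ↭-unique (rowLabels-unique r) (Unique.filter⁺ (T? ∘ q ∘ toℕ) (Unique.allFin⁺ (suc n))) λ {g} → mk⇔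
      (λ g∈ → Equivalence.from (∈-gens q g) (sound (∈rowLabels⇒InRow g g∈)))
      (λ g∈ → InRow⇒∈rowLabels g (complete (toℕ g) (ℕ.≤-pred (toℕ<n g)) (Equivalence.to (∈-gens q g) g∈)))

  module _ (¬lwsr : ∀ s t → ¬ LeftWeakStarRed s t w) where

    ¬cancel3 : ∀ {s t} → InRow 1 s → InRow 2 t → Adj s t → mℕ n s t ≡ 3 → ¬ SoleNeighbour 1 t s
    ¬cancel3 {s} {t} p q adj m≡3 sole with Any-order heap p q
    ... | inj₂ (inj₂ both) with _ , (_ , r₁) , (_ , r₂) ← Any.satisfied both = ℕ.1+n≢n (trans (sym r₂) r₁)
    ... | inj₂ (inj₁ (_ , _ , (l₁ , r₁) , (l₂ , r₂) , eT<eS)) =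
      ℕ.<-asym (ℕ.n<1+n 1) (subst₂ _<_ r₁ r₂ (Before-near⇒row< eT<eS (subst₂ Near (sym l₂) (sym l₁) (inj₂ adj))))
    ... | inj₁ (eS , eT , atS@(lS , rS) , atT , A , B , C , eq) =
      ¬lwsr (label eS) (label eT) (leftWeakStarRed-3 (map label A) (map label B) (map label C) (w-split₂ eq)
        (commute-before-row1 eq rS)
        (commute-before-row2 A atT atS sole λ e∈A → Before-prefix eq′ (Any.++⁺ˡ e∈A) , inj₁ (Before-prefix eq e∈A))
        (commute-before-row2 B atT atS sole λ e∈B →
          Before-prefix eq′ (Any.++⁺ʳ A (there e∈B)) , inj₂ (proj₁ (Before-around eq e∈B)))
        (subst₂ (λ x y → mℕ n x y ≡ 3) (sym lS) (sym (proj₁ atT)) m≡3) w-reduced w-fc)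
      where
      eq′ : heap ≡ (A ++ eS ∷ B) ++ eT ∷ C
      eq′ = trans eq (sym (++-assoc A (eS ∷ B) (eT ∷ C)))

    ¬cancel4 : ∀ {s t} → InRow 1 s → InRow 2 t → InRow 3 s → Adj s t → mℕ n s t ≡ 4 →
               SoleNeighbour 1 t s → ¬ SoleNeighbour 2 s t
    ¬cancel4 {s} {t} p q p′ adj m≡4 sole₁ sole₂ =
      ¬lwsr (label e₁) (label e₂) (leftWeakStarRed-4 (map label A) (map label B₁) (map label B₂) (map label C) w≡
        (commute-before-row1 split (proj₂ at₁))
        (commute-before-row2 A at₂ at₁ sole₁ λ e∈A → Before-prefix split₂ (Any.++⁺ˡ e∈A) , inj₁ (Before-prefix split e∈A))
        (commute-before-row2 B₁ at₂ at₁ sole₁ λ e∈B₁ →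
          Before-prefix split₂ (Any.++⁺ʳ A (there e∈B₁)) , inj₂ (proj₁ (Before-around split₁ e∈B₁)))
        (proj₁ commuting) (proj₂ commuting)
        (subst₂ (λ x y → mℕ n x y ≡ 4) (sym (proj₁ at₁)) (sym (proj₁ at₂)) m≡4) w-reduced w-fc)
      where
      open Zigzag (zigzag p q p′ adj)
      split₁ : heap ≡ A ++ e₁ ∷ B₁ ++ e₂ ∷ (B₂ ++ e₃ ∷ C)
      split₁ = trans split (cong (λ X → A ++ e₁ ∷ X) (++-assoc B₁ (e₂ ∷ B₂) (e₃ ∷ C)))
      split₂ : heap ≡ (A ++ e₁ ∷ B₁) ++ e₂ ∷ (B₂ ++ e₃ ∷ C)
      split₂ = trans split₁ (sym (++-assoc A (e₁ ∷ B₁) _))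
      commuting : All (Commute (label e₁)) (map label B₁) × All (Commute (label e₁)) (map label B₂)
      commuting = commute-around split at₁ at₂ at₃ sole₂
      w≡ : w ≡ map label A ++ label e₁ ∷ map label B₁ ++ label e₂ ∷ map label B₂ ++ label e₁ ∷ map label C
      w≡ = trans (w-split₃ split)
        (cong (λ g → map label A ++ label e₁ ∷ map label B₁ ++ label e₂ ∷ map label B₂ ++ g ∷ map label C)
              (toℕ-injective (trans (proj₁ at₃) (sym (proj₁ at₁)))))

    -- In a left corner the entry c + 1 of row ρ + 1 is covered by c only; right corners are mirrored.
    LeftCorner : ℕ → ℕ → Set
    LeftCorner ρ c = InRow ρ c × InRow (suc ρ) (suc c) × ¬ InRow ρ (suc (suc c))

    RightCorner : ℕ → ℕ → Set
    RightCorner ρ e = InRow ρ (suc e) × InRow (suc ρ) e × ¬ InRow ρ (e ∸ 1)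

    sole-left : ∀ {ρ c} → ¬ InRow ρ (suc (suc c)) → SoleNeighbour ρ (suc c) c
    sole-left gap d p (inj₁ refl) = contradiction p gap
    sole-left gap d p (inj₂ refl) = refl

    sole-right : ∀ {ρ e} → ¬ InRow ρ (e ∸ 1) → SoleNeighbour ρ e (suc e)
    sole-right gap d p (inj₁ refl) = refl
    sole-right gap d p (inj₂ refl) = contradiction p gap

    sole-at-0 : ∀ {ρ} → SoleNeighbour ρ 0 1
    sole-at-0 d p (inj₁ refl) = refl

    sole-at-n : ∀ {ρ e} → suc e ≡ n → SoleNeighbour ρ (suc e) e
    sole-at-n wall d p (inj₁ refl) = contradiction (InRow-bound p) (ℕ.<-irrefl wall)
    sole-at-n wall d p (inj₂ refl) = refl

    LeftCorner-gap : ∀ {r c} → suc (suc (suc c)) ≤ n → LeftCorner (suc (suc r)) (suc c) → ¬ InRow (suc r) (suc (suc c))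
    LeftCorner-gap {c = c} bound (p , q , gap) p′ =
      ¬braid3 p′ p q (inj₂ refl) (mℕ-interiorʳ n (suc c) (s≤s z≤n) bound) (sole-left gap)

    LeftCorner-climb : ∀ {r c} → suc (suc (suc c)) ≤ n → LeftCorner (suc (suc r)) (suc c) → LeftCorner (suc r) c
    LeftCorner-climb bound corner@(p , _) with covered p
    ... | inj₁ p′ = contradiction p′ (LeftCorner-gap bound corner)
    ... | inj₂ (_ , refl , p′) = p′ , p , LeftCorner-gap bound corner

    RightCorner-gap : ∀ {r e} → 1 ≤ e → suc (suc e) ≤ n → RightCorner (suc (suc r)) e → ¬ InRow (suc r) e
    RightCorner-gap {e = e} 1≤e bound (p , q , gap) p′ =
      ¬braid3 p′ p q (inj₁ refl) (mℕ-interior n e 1≤e bound) (sole-right gap)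

    RightCorner-climb : ∀ {r e} → 1 ≤ e → suc (suc e) ≤ n → RightCorner (suc (suc r)) e → RightCorner (suc r) (suc e)
    RightCorner-climb 1≤e bound corner@(p , _) with covered p
    ... | inj₁ p′ = p′ , p , RightCorner-gap 1≤e bound corner
    ... | inj₂ (_ , refl , p′) = contradiction p′ (RightCorner-gap 1≤e bound corner)

    ¬LeftCorner-1 : ∀ {c} → 1 ≤ c → suc (suc c) ≤ n → ¬ LeftCorner 1 c
    ¬LeftCorner-1 {c} 1≤c bound (p , q , gap) = ¬cancel3 p q (inj₁ refl) (mℕ-interior n c 1≤c bound) (sole-left gap)

    ¬RightCorner-1 : ∀ {e} → 1 ≤ e → suc (suc e) ≤ n → ¬ RightCorner 1 e
    ¬RightCorner-1 {e} 1≤e bound (p , q , gap) = ¬cancel3 p q (inj₂ refl) (mℕ-interiorʳ n e 1≤e bound) (sole-right gap)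

    -- A left corner at column l and a right corner at column e < l in the same row both climb
    -- towards each other until they collide.
    ¬corners-meet : ∀ ρ d e → LeftCorner ρ (d + suc e) → RightCorner ρ e → 1 ≤ e → suc (suc (d + suc e)) ≤ n → ⊥
    ¬corners-meet zero _ _ (p , _) _ _ _ = ¬InRow-0 p
    ¬corners-meet (suc zero) d e left _ _ bound = ¬LeftCorner-1 (ℕ.≤-trans (s≤s z≤n) (ℕ.m≤n+m (suc e) d)) bound left
    ¬corners-meet (suc (suc ρ)) zero e left (p , q , gap) 1≤e bound =
      ¬braid3 (proj₁ (LeftCorner-climb bound left)) p q (inj₁ refl) (mℕ-interior n e 1≤e (ℕ.<⇒≤ bound)) (sole-right gap)
    ¬corners-meet (suc (suc ρ)) (suc zero) e (p , _) (q , _) _ _ = ¬InRow-adjacent q p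
    ¬corners-meet (suc (suc ρ)) (suc (suc d)) e left right 1≤e bound =
      ¬corners-meet (suc ρ) d (suc e)
        (subst (LeftCorner (suc ρ)) (sym (ℕ.+-suc d (suc e))) (LeftCorner-climb bound left))
        (RightCorner-climb 1≤e (ℕ.≤-trans (s≤s (ℕ.m≤n+m (suc e) (suc (suc d)))) (ℕ.<⇒≤ bound)) right)
        (s≤s z≤n) (subst (λ k → suc (suc k) ≤ n) (sym (ℕ.+-suc d (suc e))) (ℕ.<⇒≤ bound))

    LeftStaircase : ℕ → ℕ → Set
    LeftStaircase r D = ∀ i → i ≤ D → LeftCorner (i + r) i

    climb-left : ∀ c ρ → LeftCorner ρ c → suc (suc c) ≤ n → ∃[ r ] (c + r ≡ ρ × LeftStaircase r c)
    climb-left zero ρ corner _ = ρ , refl , λ { zero _ → corner }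
    climb-left (suc c) zero (p , _) _ = contradiction p ¬InRow-0
    climb-left (suc c) (suc zero) corner bound = contradiction corner (¬LeftCorner-1 (s≤s z≤n) bound)
    climb-left (suc c) (suc (suc ρ)) corner bound
      with r , eq , stair ← climb-left c (suc ρ) (LeftCorner-climb bound corner) (ℕ.<⇒≤ bound) =
      r , cong suc eq , extend
      where
      extend : LeftStaircase r (suc c)
      extend i i≤ with ℕ.m≤n⇒m<n∨m≡n i≤
      ... | inj₁ i<  = stair i (ℕ.≤-pred i<)
      ... | inj₂ refl = subst (λ k → LeftCorner k (suc c)) (cong suc (sym eq)) corner

    -- The corner in row i + r sits at column n − 1 − i, stated without subtraction.
    RightStaircase : ℕ → ℕ → Set
    RightStaircase r D = ∀ i e → i ≤ D → suc (i + e) ≡ n → RightCorner (i + r) e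

    climb-right : ∀ g ρ e → g + suc e ≡ n → 1 ≤ e → RightCorner ρ e → ∃[ r ] (g + r ≡ ρ × RightStaircase r g)
    climb-right zero ρ e wall _ corner =
      ρ , refl , λ { zero e′ _ wall′ → subst (RightCorner ρ) (ℕ.suc-injective (trans wall (sym wall′))) corner }
    climb-right (suc g) zero e _ _ (p , _) = contradiction p ¬InRow-0
    climb-right (suc g) (suc zero) e wall 1≤e corner =
      contradiction corner (¬RightCorner-1 1≤e (ℕ.≤-trans (s≤s (ℕ.m≤n+m (suc e) g)) (ℕ.≤-reflexive wall)))
    climb-right (suc g) (suc (suc ρ)) e wall 1≤e corner
      with r , eq , stair ← climb-right g (suc ρ) (suc e) (trans (ℕ.+-suc g (suc e)) wall) (s≤s z≤n)
             (RightCorner-climb 1≤e (ℕ.≤-trans (s≤s (ℕ.m≤n+m (suc e) g)) (ℕ.≤-reflexive wall)) corner) =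
      r , cong suc eq , extend
      where
      extend : RightStaircase r (suc g)
      extend i e′ i≤ wall′ with ℕ.m≤n⇒m<n∨m≡n i≤
      ... | inj₁ i<  = stair i e′ (ℕ.≤-pred i<) wall′
      ... | inj₂ refl = subst₂ RightCorner (cong suc (sym eq))
                          (sym (ℕ.+-cancelˡ-≡ (suc g) _ _
                            (ℕ.suc-injective (trans wall′ (sym (trans (sym (ℕ.+-suc (suc g) e)) wall))))))
                          corner

    first-below : ∀ x r {T} → r < T → InRow T x →
      ∃[ o ] (InRow (suc (o + r)) x × (∀ {i} → i < o → ¬ InRow (suc (i + r)) x) × suc (o + r) ≤ T)
    first-below x r {T} r<T p with d , eq ← ℕ.m≤n⇒∃[o]m+o≡n r<T = bounded (least (λ i → InRow? (suc (i + r)) x) pd)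
      where
      eq′ : suc (d + r) ≡ T
      eq′ = trans (cong suc (ℕ.+-comm d r)) eq
      pd : InRow (suc (d + r)) x
      pd = subst (λ t → InRow t x) (sym eq′) p
      bounded : ∃[ o ] (InRow (suc (o + r)) x × (∀ {i} → i < o → ¬ InRow (suc (i + r)) x)) →
                ∃[ o ] (InRow (suc (o + r)) x × (∀ {i} → i < o → ¬ InRow (suc (i + r)) x) × suc (o + r) ≤ T)
      bounded (o , p₀ , minimal) =
        o , p₀ , minimal , ℕ.≤-trans (s≤s (ℕ.+-monoˡ-≤ r (ℕ.≮⇒≥ λ d<o → minimal d<o pd))) (ℕ.≤-reflexive eq′)

    ¬left-wall-zigzag : ∀ r → LeftCorner r 0 → ¬ InRow (suc (suc r)) 0
    ¬left-wall-zigzag zero (p , _) _ = ¬InRow-0 p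
    ¬left-wall-zigzag (suc zero) (p , q , gap) p′ = ¬cancel4 p q p′ (inj₁ refl) refl (sole-left gap) sole-at-0
    ¬left-wall-zigzag (suc (suc r)) (p , q , gap) p′ with covered p
    ... | inj₁ q₀ = ¬braid4 q₀ p q p′ (inj₁ refl) refl (sole-left gap) sole-at-0

    -- The topmost 0 below the staircase is covered by a 1, which either collides with the staircase
    -- or starts a right corner that meets it.
    ¬left-wall : ∀ r D T → LeftStaircase r D → InRow T 0 → r < T → T ≤ suc (D + r) → suc (suc D) ≤ n → ⊥
    ¬left-wall r D T stair p r<T T≤ bound with first-below 0 r r<T p
    ... | o , p₀ , minimal , o≤T = topmost o p₀ minimal (ℕ.+-cancelʳ-≤ r o D (ℕ.≤-pred (ℕ.≤-trans o≤T T≤)))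
      where
      topmost : ∀ o → InRow (suc (o + r)) 0 → (∀ {i} → i < o → ¬ InRow (suc (i + r)) 0) → o ≤ D → ⊥
      topmost zero p₀ _ _ = ¬InRow-adjacent p₀ (proj₁ (proj₂ (stair 0 z≤n)))
      topmost (suc zero) p₀ _ _ = ¬left-wall-zigzag r (stair 0 z≤n) p₀
      topmost (suc (suc zero)) p₀ _ o≤D with covered p₀
      ... | inj₁ q = ¬InRow-adjacent q (proj₁ (stair 2 o≤D))
      topmost (suc (suc (suc j))) p₀ minimal o≤D with covered p₀
      ... | inj₁ q with covered q
      ...   | inj₂ (_ , refl , p0) = minimal (n<2+n (suc j)) p0
      ...   | inj₁ p₂ = ¬corners-meet (suc (suc (j + r))) j 1
                          (subst (LeftCorner _) (ℕ.+-comm 2 j) (stair (suc (suc j)) j+2≤D))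
                          (p₂ , q , minimal (n<2+n (suc j))) (s≤s z≤n)
                          (ℕ.≤-trans (s≤s (s≤s (subst (_≤ D) (ℕ.+-comm 2 j) j+2≤D))) bound)
        where
        j+2≤D : suc (suc j) ≤ D
        j+2≤D = ℕ.<⇒≤ o≤D

    ¬right-wall-zigzag : ∀ r e → suc e ≡ n → RightCorner r e → ¬ InRow (suc (suc r)) (suc e)
    ¬right-wall-zigzag zero _ _ (p , _) _ = ¬InRow-0 p
    ¬right-wall-zigzag (suc zero) e wall (p , q , gap) p′ =
      ¬cancel4 p q p′ (inj₂ refl) (subst (λ k → mℕ k (suc e) e ≡ 4) wall (mℕ-lastʳ e)) (sole-right gap) (sole-at-n wall)
    ¬right-wall-zigzag (suc (suc r)) e wall (p , q , gap) p′ with covered p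
    ... | inj₁ p⁺ = contradiction (InRow-bound p⁺) (ℕ.<-irrefl wall)
    ... | inj₂ (_ , refl , q₀) =
      ¬braid4 q₀ p q p′ (inj₂ refl) (subst (λ k → mℕ k e (suc e) ≡ 4) wall (mℕ-last e)) (sole-right gap) (sole-at-n wall)

    ¬right-wall : ∀ r D T → RightStaircase r D → InRow T n → r < T → T ≤ suc (D + r) → suc (suc D) ≤ n → ⊥
    ¬right-wall r D T stair p r<T T≤ bound
      with e , wall ← ℕ.m≤n⇒∃[o]m+o≡n (ℕ.≤-trans (s≤s z≤n) bound) | first-below n r r<T p
    ... | o , p₀ , minimal , o≤T =
      topmost o (subst (InRow _) (sym wall) p₀) (λ i<o → minimal i<o ∘ subst (InRow _) wall)
              (ℕ.+-cancelʳ-≤ r o D (ℕ.≤-pred (ℕ.≤-trans o≤T T≤)))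
      where
      topmost : ∀ o → InRow (suc (o + r)) (suc e) → (∀ {i} → i < o → ¬ InRow (suc (i + r)) (suc e)) → o ≤ D → ⊥
      topmost zero p₀ _ _ = ¬InRow-adjacent (proj₁ (proj₂ (stair 0 e z≤n wall))) p₀
      topmost (suc zero) p₀ _ _ = ¬right-wall-zigzag r e wall (stair 0 e z≤n wall) p₀
      topmost (suc (suc zero)) p₀ _ o≤D
        with covered p₀ | ℕ.m≤n⇒∃[o]m+o≡n (ℕ.≤-trans (s≤s (s≤s (s≤s z≤n))) (ℕ.≤-trans (s≤s (s≤s o≤D)) bound))
      ... | inj₁ p⁺ | _ = contradiction (InRow-bound p⁺) (ℕ.<-irrefl wall)
      ... | inj₂ (_ , refl , q) | e₂ , wall₂ =
        ¬InRow-adjacent (proj₁ (stair 2 e₂ o≤D wall₂)) (subst (InRow _) (ℕ.suc-injective (trans wall (sym wall₂))) q)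
      topmost (suc (suc (suc j))) p₀ minimal o≤D
        with covered p₀ | ℕ.m≤n⇒∃[o]m+o≡n (ℕ.≤-trans o≤D (ℕ.≤-trans (ℕ.m≤n+m D 2) bound))
      ... | inj₁ p⁺ | _ = contradiction (InRow-bound p⁺) (ℕ.<-irrefl wall)
      ... | inj₂ (_ , refl , q) | eᵢ , wallᵢ with covered q
      ...   | inj₁ p⁺ = minimal (n<2+n (suc j)) p⁺
      ...   | inj₂ (y , refl , q₂) = ¬corners-meet (suc (suc (j + r))) j eᵢ
                  (subst (LeftCorner _) y≡ (q₂ , q , minimal (n<2+n (suc j))))
                  (stair (suc (suc j)) eᵢ (ℕ.<⇒≤ o≤D) wallᵢ) 1≤eᵢ
                  (ℕ.≤-reflexive (trans (cong (suc ∘ suc) (sym y≡)) wall))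
        where
        y≡ : y ≡ j + suc eᵢ
        y≡ = trans (ℕ.suc-injective (ℕ.suc-injective (trans wall (sym wallᵢ)))) (sym (ℕ.+-suc j eᵢ))
        1≤eᵢ : 1 ≤ eᵢ
        1≤eᵢ = ℕ.+-cancelˡ-≤ (3 + j) 1 eᵢ
          (subst₂ _≤_ (ℕ.+-comm 1 (3 + j)) (sym wallᵢ) (ℕ.≤-trans (s≤s o≤D) (ℕ.<⇒≤ bound)))

    odd-row-below : ∀ k → 1 ≤ k → (∀ x → x ≤ n → evenℕ x ≡ true → InRow (suc k) x) →
                    ∀ x → x ≤ n → evenℕ x ≡ false → InRow k x
    odd-row-below (suc k) _ evens zero _ ()
    odd-row-below (suc k) _ evens (suc x) x<n odd with InRow? (suc k) (suc x)
    ... | yes p = p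
    ... | no ¬p with covered (evens x (ℕ.<⇒≤ x<n) (not-injective odd))
    ...   | inj₁ p = contradiction p ¬p
    ...   | inj₂ (zero , refl , _) = contradiction odd λ ()
    ...   | inj₂ (suc y , refl , q)
      with r , eq , stair ← climb-left (suc y) (suc k) (q , evens x (ℕ.<⇒≤ x<n) (not-injective odd) , ¬p) x<n =
      ⊥-elim (¬left-wall r (suc y) (suc (suc k)) stair (evens 0 z≤n refl)
               (s≤s (subst (r ≤_) eq (ℕ.m≤n+m r (suc y)))) (ℕ.≤-reflexive (cong suc (sym eq))) x<n)

    even-interior : ∀ k → (∀ x → x ≤ n → evenℕ x ≡ false → InRow (suc (suc k)) x) →
                    ∀ y → suc (suc y) ≤ n → evenℕ y ≡ true → 2 ≤ y → InRow (suc k) (suc (suc y))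
    even-interior k odds y@(suc (suc d)) y+2≤n ev _ with InRow? (suc k) (suc (suc y))
    ... | yes p = p
    ... | no ¬p with covered (odds (suc y) (ℕ.<⇒≤ y+2≤n) (cong not ev))
    ...   | inj₁ p = p
    ...   | inj₂ (_ , refl , q) = ⊥-elim (at-corner (q , odds (suc y) (ℕ.<⇒≤ y+2≤n) (cong not ev) , ¬p))
      where
      at-corner : LeftCorner (suc k) y → ⊥
      at-corner corner with InRow? (suc k) 0
      ... | yes p₀ with r , eq , stair ← climb-left y (suc k) corner y+2≤n =
        ¬left-wall r y (suc k) stair p₀ (subst (r <_) eq (ℕ.m<n+m r (s≤s z≤n)))
                   (ℕ.≤-trans (ℕ.≤-reflexive (sym eq)) (ℕ.n≤1+n _)) y+2≤n
      ... | no ¬p₀ with covered (odds 1 (ℕ.≤-trans (s≤s z≤n) y+2≤n) refl)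
      ...   | inj₂ (_ , refl , p₀) = ¬p₀ p₀
      ...   | inj₁ p₂ =
        ¬corners-meet (suc k) d 1 (subst (LeftCorner (suc k)) (ℕ.+-comm 2 d) corner)
          (p₂ , odds 1 (ℕ.≤-trans (s≤s z≤n) y+2≤n) refl , ¬p₀) (s≤s z≤n)
          (subst (λ z → suc (suc z) ≤ n) (ℕ.+-comm 2 d) y+2≤n)

    -- For x ∈ {0, 2} the right corner at x + 1 climbs to the right wall; there the parity of n
    -- decides which row below the staircase contains n.
    even-left : ∀ k → 5 ≤ n → (∀ x → x ≤ n → evenℕ x ≡ false → InRow (suc (suc k)) x) →
                ∀ x → x ≤ 2 → evenℕ x ≡ true → InRow (suc k) x
    even-left k 5≤n odds x x≤2 ev with InRow? (suc k) x
    ... | yes p = p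
    ... | no ¬p with covered (odds (suc x) (ℕ.≤-trans (s≤s x≤2) (ℕ.≤-trans (ℕ.n≤1+n 3) (ℕ.<⇒≤ 5≤n))) (cong not ev))
    ...   | inj₂ (_ , refl , p) = p
    ...   | inj₁ q = ⊥-elim (towards-wall (ℕ.m≤n⇒∃[o]m+o≡n x+2≤n))
      where
      x+2≤n : suc (suc x) ≤ n
      x+2≤n = ℕ.≤-trans (s≤s (s≤s x≤2)) (ℕ.<⇒≤ 5≤n)
      towards-wall : ∃[ g ] (suc (suc x) + g ≡ n) → ⊥
      towards-wall (g , wall) =
        at-wall (climb-right g (suc k) (suc x) wall′ (s≤s z≤n) (q , odds (suc x) (ℕ.<⇒≤ x+2≤n) (cong not ev) , ¬p))
        where
        wall′ : g + suc (suc x) ≡ n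
        wall′ = trans (ℕ.+-comm g _) wall
        g+2≤n : suc (suc g) ≤ n
        g+2≤n = ℕ.≤-trans (ℕ.≤-reflexive (ℕ.+-comm 2 g)) (subst (g + 2 ≤_) wall′ (ℕ.+-monoʳ-≤ g (s≤s (s≤s z≤n))))
        1≤g : 1 ≤ g
        1≤g = ℕ.+-cancelʳ-≤ (suc (suc x)) 1 g (subst (3 + x ≤_) (sym wall′) (ℕ.≤-trans (s≤s (s≤s (s≤s x≤2))) 5≤n))
        at-wall : ∃[ r ] (g + r ≡ suc k × RightStaircase r g) → ⊥
        at-wall (r , eq , stair) with evenℕ n in parity
        ... | false = ¬right-wall r g (suc (suc k)) stair (odds n ℕ.≤-refl parity)
                        (s≤s (subst (r ≤_) eq (ℕ.m≤n+m r g))) (ℕ.≤-reflexive (cong suc (sym eq))) g+2≤n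
        ... | true with InRow? (suc k) n
        ...   | yes pn = ¬right-wall r g (suc k) stair pn (subst (r <_) eq (ℕ.m<n+m r 1≤g))
                           (ℕ.≤-trans (ℕ.≤-reflexive (sym eq)) (ℕ.n≤1+n _)) g+2≤n
        ...   | no ¬pn with y , refl ← ℕ.m≤n⇒∃[o]m+o≡n (ℕ.≤-trans (s≤s (s≤s z≤n)) 5≤n) =
          ¬pn (even-interior k odds y ℕ.≤-refl (trans (sym (not-involutive (evenℕ y))) parity)
                 (ℕ.≤-pred (ℕ.≤-pred (ℕ.≤-trans (s≤s (s≤s (s≤s (s≤s z≤n)))) 5≤n))))

    even-row-below : ∀ k → 1 ≤ k → 5 ≤ n → (∀ x → x ≤ n → evenℕ x ≡ false → InRow (suc k) x) →
                     ∀ x → x ≤ n → evenℕ x ≡ true → InRow k x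
    even-row-below (suc k) _ 5≤n odds 0 _ ev = even-left k 5≤n odds 0 z≤n ev
    even-row-below (suc k) _ 5≤n odds 1 _ ()
    even-row-below (suc k) _ 5≤n odds 2 _ ev = even-left k 5≤n odds 2 ℕ.≤-refl ev
    even-row-below (suc k) _ 5≤n odds 3 _ ()
    even-row-below (suc k) _ 5≤n odds (suc (suc (suc (suc y)))) x≤n ev =
      even-interior k odds (suc (suc y)) x≤n (trans (sym (not-involutive _)) ev) (s≤s (s≤s z≤n))

    rows-below-xO : ∀ k → 1 ≤ k → RowIs w (suc k) (xO n) → RowIs w k (xE n)
    rows-below-xO k 1≤k ρ = InRow⇒RowIs k (not ∘ evenℕ) sound complete
      where
      evens : ∀ x → x ≤ n → evenℕ x ≡ true → InRow (suc k) x
      evens = RowIs⇒InRow evenℕ ρ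
      sound : ∀ {x} → InRow k x → not (evenℕ x) ≡ true
      sound {x} p with evenℕ x in ev
      ... | true  = contradiction (evens x (InRow-bound p) ev) (¬InRow-successive p)
      ... | false = refl
      complete : ∀ x → x ≤ n → not (evenℕ x) ≡ true → InRow k x
      complete x x≤n odd = odd-row-below k 1≤k evens x x≤n (not-injective odd)

    rows-below-xE : 5 ≤ n → ∀ k → 1 ≤ k → RowIs w (suc k) (xE n) → RowIs w k (xO n)
    rows-below-xE 5≤n k 1≤k ρ = InRow⇒RowIs k evenℕ sound complete
      where
      odds : ∀ x → x ≤ n → evenℕ x ≡ false → InRow (suc k) x
      odds x x≤n odd = RowIs⇒InRow (not ∘ evenℕ) ρ x x≤n (cong not odd)
      sound : ∀ {x} → InRow k x → evenℕ x ≡ true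
      sound {x} p with evenℕ x in ev
      ... | true  = refl
      ... | false = contradiction (odds x (InRow-bound p) ev) (¬InRow-successive p)
      complete : ∀ x → x ≤ n → evenℕ x ≡ true → InRow k x
      complete = even-row-below k 1≤k 5≤n odds

lemma5p9 : (n : ℕ) → 4 < n → (w : Word n) → Reduced w → FC w → NonCancellable w →
    (k : ℕ) → 1 ≤ k →
    (RowIs w (suc k) (xO n) → RowIs w k (xE n)) × (RowIs w (suc k) (xE n) → RowIs w k (xO n))
lemma5p9 n 4<n w w-reduced w-fc nc k 1≤k = rows-below-xO ¬lwsr k 1≤k , rows-below-xE ¬lwsr 4<n k 1≤k
  where
  open HeapOf w w-reduced w-fc
  ¬lwsr : ∀ s t → ¬ LeftWeakStarRed s t w
  ¬lwsr s t = proj₁ (nc s t)
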